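{- Define $s(n)$ by $$\sum_{n\ge0}s(n)q^n=\frac{(-q^2;q^2)_\infty}{(q^2;q^2)_\infty}(q^6;q^6)_\infty(-q^3;q^6)_\infty^2\left(=\sum_{n\ge0}\frac{(-1;q^2)_nq^{n(n+1)}}{(q;q)_{2n}}\right).$$ Then for all integers $n\ge0$: $s(24n+i)\equiv0\pmod 4$ for $i\in\{9,15,21\}$; $s(24n+23)\equiv0\pmod 8$; $s(24n+17)\equiv0\pmod 8$; and $s(12n+1)\equiv0\pmod{16}$.
   Context: $(A;q)_n=\prod_{k=0}^{n-1}(1-Aq^k)$, $(A;q)_\infty=\prod_{k\ge0}(1-Aq^k)$, $|q|<1$. -}

module Defs where

open import Data.Nat as ℕ using (ℕ; zero; suc; _∸_)
open import Data.Integer using (ℤ; +_; -_; _+_; _*_)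
open import Data.List using (List; map; upTo)
import Data.Integer as ℤ
open import Data.Nat.Divisibility using (_∣?_)
open import Relation.Nullary.Decidable using (does)
open import Data.Bool using (if_then_else_)

PS : Set
PS = ℕ → ℤ

sumℤ : List ℤ → ℤ
sumℤ = Data.List.foldr _+_ (+ 0)

_⊛_ : PS → PS → PS
(f ⊛ g) n = sumℤ (map (λ k → f k * g (n ∸ k)) (upTo (suc n)))

infixl 7 _⊛_

one : PS
one zero    = + 1
one (suc _) = + 0

-- 1 + c q^m  (for m ≥ 1)
binom : ℤ → ℕ → PS
binom c m zero    = + 1
binom c m (suc n) = if does (suc n ℕ.≟ m) then c else + 0

-- 1/(1 - q^m) = Σ_{j≥0} q^{m j}  (for m ≥ 1): coefficient of q^n is 1 iff m ∣ n.
geom : ℕ → PS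
geom m n = if does (m ∣? n) then + 1 else + 0

-- The k-th factor (k ≥ 1) of
--   (-q²;q²)_∞ / (q²;q²)_∞ · (q⁶;q⁶)_∞ · (-q³;q⁶)_∞²
--   = ∏_{k≥1} (1+q^{2k}) · 1/(1-q^{2k}) · (1-q^{6k}) · (1+q^{6k-3})².
factor : ℕ → PS
factor k = binom (+ 1) (2 ℕ.* k) ⊛ geom (2 ℕ.* k) ⊛ binom (- + 1) (6 ℕ.* k)
           ⊛ binom (+ 1) (6 ℕ.* k ∸ 3) ⊛ binom (+ 1) (6 ℕ.* k ∸ 3)

partialProd : ℕ → PS
partialProd zero    = one
partialProd (suc N) = partialProd N ⊛ factor (suc N)

-- The k-th factor is
-- ≡ 1 mod q^{2k}, so factors with k > n do not affect the coefficient of q^n;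
-- hence the coefficient of q^n of the infinite product is that of the
-- partial product up to k = n + 1.
s : ℕ → ℤ
s n = partialProd (suc n) n

{-# OPTIONS --safe #-}
-- The generating function is (1 + 2Y) / (1 + 2X) with X = Σ_{n≥1} (-1)ⁿ q^(2n²) and
-- Y = Σ_{n≥1} q^(3n²): by the Jacobi triple product, (q⁶;q⁶)(-q³;q⁶)² = 1 + 2Y and
-- (q²;q²)/(-q²;q²) = 1 + 2X.  Writing 1/(1 + 2X) = C + 16X⁴/(1 + 2X) with C = 1 - 2X + 4X² - 8X³,
-- and X² = D + 2O with diagonal part D = Σ_{n≥1} q^(4n²), the series becomes
--   C + 2(Y + 2(-XY + 2(DY + 2Z)))
-- for an integral series Z.  Modulo 24 the exponents of C are even, those of Y are 3n², of XY
-- 2m² + 3n² and of DY 4m² + 3n²; the residues 9, 15, 21 avoid the first two kinds, 17 and 23 the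
-- first three, and 1 and 13 all four.
--
-- All identities are proved for partial products, which agree with the infinite ones below a
-- precision exceeding the exponent of interest.  The triple product is used in its finite form
--   Σ_{|j|≤N} zʲ x^(j²) [2N, N+j]_{x²} = ∏_{k=1}^{N} (1 + z x^(2k-1)) (1 + z⁻¹ x^(2k-1))   (z = ±1),
-- proved by induction on N; Gauss's identity for 1 + 2X then also needs Euler's (-q²;q²)(q²;q⁴) = 1.
module Submission where

open import Defs
open import Data.Nat using (ℕ)
open import Data.Integer using (+_)
open import Data.Integer.Divisibility using (_∣_)
open import Data.Product using (_×_)
import Data.Nat as N

open import Algebra.Bundles using (AbelianGroup; CommutativeRing)
open import Algebra.Structures using (IsCommutativeRing)
import Algebra.Solver.Ring.AlmostCommutativeRing as ACR
open import Data.Bool using (Bool; true; false; T; not; _∧_; _∨_; if_then_else_)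
open import Data.Bool.ListAction using (any; all)
open import Data.Integer as ℤ using (ℤ)
open import Data.Integer.Divisibility using (*-monoʳ-∣)
import Data.Integer.Properties as ℤ
import Data.Integer.Tactic.RingSolver as ℤ-Solver
open import Data.List using (List; []; _∷_; map; upTo)
open import Data.List.Properties using (map-cong; map-cong-local; map-upTo; map-applyUpTo)
open import Data.List.Relation.Unary.All using (All; []; _∷_)
open import Data.List.Relation.Unary.All.Properties using (applyUpTo⁺₁; applyUpTo⁻; all⁺; map⁺)
open import Data.Maybe using (Maybe; just; nothing)
open import Data.Nat using (zero; suc; _+_; _*_; _∸_; _≤_; _<_; z≤n; s≤s; NonZero)
open import Data.Nat.Divisibility using (_∣?_; _∣0; 1∣_; ∣-refl; ∣⇒≤; ∣m∣n⇒∣m+n; ∣m+n∣m⇒∣n)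
  renaming (_∣_ to _∣ℕ_)
open import Data.Nat.DivMod using (_%_; m%n<n; %-distribˡ-+; %-distribˡ-*; [m+kn]%n≡m%n)
import Data.Nat.Properties as ℕ
import Data.Nat.Tactic.RingSolver as ℕ-Solver
open import Data.Product using (_,_)
open import Data.Sum as Sum using (_⊎_; inj₁; inj₂; [_,_]′)
open import Data.Unit using (tt)
open import Function using (_∘_; id)
open import Level using (0ℓ)
open import Relation.Binary.Bundles using (Setoid)
open import Relation.Binary.PropositionalEquality
import Relation.Binary.Reasoning.Setoid
open import Relation.Nullary using (¬_; Dec; yes; no; contradiction)
open import Relation.Nullary.Decidable using (dec-true; dec-false; T?)
open import Algebra.Properties.Group (AbelianGroup.group ℤ.+-0-abelianGroup) using (∙-cancelˡ)

-- The ring ℤ[[q]]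

tail : PS → PS
tail f n = f (suc n)

⊛-zero : ∀ f g → (f ⊛ g) 0 ≡ f 0 ℤ.* g 0
⊛-zero f g = ℤ.+-identityʳ _

⊛-suc : ∀ f g n → (f ⊛ g) (suc n) ≡ f 0 ℤ.* g (suc n) ℤ.+ (tail f ⊛ g) n
⊛-suc f g n = cong (λ xs → f 0 ℤ.* g (suc n) ℤ.+ sumℤ xs)
  (trans (map-applyUpTo suc (λ k → f k ℤ.* g (suc n ∸ k)) (suc n))
         (sym (map-upTo (λ k → f (suc k) ℤ.* g (n ∸ k)) (suc n))))

⊛-sucʳ : ∀ f g n → (f ⊛ g) (suc n) ≡ (f ⊛ tail g) n ℤ.+ f (suc n) ℤ.* g 0
⊛-sucʳ f g zero =
  trans (⊛-suc f g 0) (cong₂ ℤ._+_ (sym (⊛-zero f (tail g))) (⊛-zero (tail f) g))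
⊛-sucʳ f g (suc n) = begin
  (f ⊛ g) (suc (suc n))
    ≡⟨ ⊛-suc f g (suc n) ⟩
  a ℤ.+ (tail f ⊛ g) (suc n)
    ≡⟨ cong (ℤ._+_ a) (⊛-sucʳ (tail f) g n) ⟩
  a ℤ.+ ((tail f ⊛ tail g) n ℤ.+ b)
    ≡⟨ sym (ℤ.+-assoc a _ b) ⟩
  a ℤ.+ (tail f ⊛ tail g) n ℤ.+ b
    ≡⟨ cong (ℤ._+ b) (sym (⊛-suc f (tail g) n)) ⟩
  (f ⊛ tail g) (suc n) ℤ.+ b ∎
  where
  open ≡-Reasoning
  a = f 0 ℤ.* g (suc (suc n))
  b = f (suc (suc n)) ℤ.* g 0

⊛-cong : ∀ {f f′ g g′} → f ≗ f′ → g ≗ g′ → f ⊛ g ≗ f′ ⊛ g′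
⊛-cong f≗f′ g≗g′ n =
  cong sumℤ (map-cong (λ k → cong₂ ℤ._*_ (f≗f′ k) (g≗g′ (n ∸ k))) (upTo (suc n)))

⊛-comm : ∀ f g → f ⊛ g ≗ g ⊛ f
⊛-comm f g zero = trans (⊛-zero f g) (trans (ℤ.*-comm (f 0) (g 0)) (sym (⊛-zero g f)))
⊛-comm f g (suc n) = begin
  (f ⊛ g) (suc n)                        ≡⟨ ⊛-suc f g n ⟩
  f 0 ℤ.* g (suc n) ℤ.+ (tail f ⊛ g) n   ≡⟨ cong₂ ℤ._+_ (ℤ.*-comm (f 0) _) (⊛-comm (tail f) g n) ⟩
  g (suc n) ℤ.* f 0 ℤ.+ (g ⊛ tail f) n   ≡⟨ ℤ.+-comm _ ((g ⊛ tail f) n) ⟩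
  (g ⊛ tail f) n ℤ.+ g (suc n) ℤ.* f 0   ≡⟨ sym (⊛-sucʳ g f n) ⟩
  (g ⊛ f) (suc n)                        ∎
  where open ≡-Reasoning

⊛-zeroˡ : ∀ f → (λ _ → + 0) ⊛ f ≗ (λ _ → + 0)
⊛-zeroˡ f zero = ⊛-zero (λ _ → + 0) f
⊛-zeroˡ f (suc n) = trans (⊛-suc (λ _ → + 0) f n) (cong (ℤ._+_ (+ 0 ℤ.* f (suc n))) (⊛-zeroˡ f n))

⊛-identityˡ : ∀ f → one ⊛ f ≗ f
⊛-identityˡ f zero = trans (⊛-zero one f) (ℤ.*-identityˡ (f 0))
⊛-identityˡ f (suc n) =
  trans (⊛-suc one f n) (trans (cong₂ ℤ._+_ (ℤ.*-identityˡ (f (suc n))) (⊛-zeroˡ f n)) (ℤ.+-identityʳ _))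

⊛-distribʳ : ∀ f g h n → ((λ m → f m ℤ.+ g m) ⊛ h) n ≡ (f ⊛ h) n ℤ.+ (g ⊛ h) n
⊛-distribʳ f g h zero = trans (⊛-zero (λ m → f m ℤ.+ g m) h)
  (trans (ℤ.*-distribʳ-+ (h 0) (f 0) (g 0)) (sym (cong₂ ℤ._+_ (⊛-zero f h) (⊛-zero g h))))
⊛-distribʳ f g h (suc n) = trans (⊛-suc (λ m → f m ℤ.+ g m) h n)
  (trans (cong (ℤ._+_ ((f 0 ℤ.+ g 0) ℤ.* h (suc n))) (⊛-distribʳ (tail f) (tail g) h n))
  (trans (interchange (f 0) (g 0) (h (suc n)) _ _)
  (sym (cong₂ ℤ._+_ (⊛-suc f h n) (⊛-suc g h n)))))
  where
  interchange : ∀ a b c x y → (a ℤ.+ b) ℤ.* c ℤ.+ (x ℤ.+ y) ≡ (a ℤ.* c ℤ.+ x) ℤ.+ (b ℤ.* c ℤ.+ y)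
  interchange = ℤ-Solver.solve-∀

⊛-scaleˡ : ∀ a f g n → ((λ m → a ℤ.* f m) ⊛ g) n ≡ a ℤ.* (f ⊛ g) n
⊛-scaleˡ a f g zero =
  trans (⊛-zero (λ m → a ℤ.* f m) g) (trans (ℤ.*-assoc a (f 0) (g 0)) (cong (a ℤ.*_) (sym (⊛-zero f g))))
⊛-scaleˡ a f g (suc n) = trans (⊛-suc (λ m → a ℤ.* f m) g n)
  (trans (cong (ℤ._+_ (a ℤ.* f 0 ℤ.* g (suc n))) (⊛-scaleˡ a (tail f) g n))
  (trans (factor-out a (f 0) (g (suc n)) _) (cong (a ℤ.*_) (sym (⊛-suc f g n)))))
  where
  factor-out : ∀ a b c x → a ℤ.* b ℤ.* c ℤ.+ a ℤ.* x ≡ a ℤ.* (b ℤ.* c ℤ.+ x)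
  factor-out = ℤ-Solver.solve-∀

⊛-assoc : ∀ f g h → (f ⊛ g) ⊛ h ≗ f ⊛ (g ⊛ h)
⊛-assoc f g h zero = begin
  ((f ⊛ g) ⊛ h) 0          ≡⟨ ⊛-zero (f ⊛ g) h ⟩
  (f ⊛ g) 0 ℤ.* h 0        ≡⟨ cong (ℤ._* h 0) (⊛-zero f g) ⟩
  f 0 ℤ.* g 0 ℤ.* h 0      ≡⟨ ℤ.*-assoc (f 0) _ _ ⟩
  f 0 ℤ.* (g 0 ℤ.* h 0)    ≡⟨ cong (f 0 ℤ.*_) (sym (⊛-zero g h)) ⟩
  f 0 ℤ.* (g ⊛ h) 0        ≡⟨ sym (⊛-zero f (g ⊛ h)) ⟩
  (f ⊛ (g ⊛ h)) 0          ∎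
  where open ≡-Reasoning
⊛-assoc f g h (suc n) = begin
  ((f ⊛ g) ⊛ h) (suc n)
    ≡⟨ ⊛-suc (f ⊛ g) h n ⟩
  (f ⊛ g) 0 ℤ.* h (suc n) ℤ.+ (tail (f ⊛ g) ⊛ h) n
    ≡⟨ cong₂ ℤ._+_ (cong (ℤ._* h (suc n)) (⊛-zero f g)) (⊛-cong {g = h} (⊛-suc f g) (λ _ → refl) n) ⟩
  f 0 ℤ.* g 0 ℤ.* h (suc n) ℤ.+ ((λ m → f 0 ℤ.* g (suc m) ℤ.+ (tail f ⊛ g) m) ⊛ h) n
    ≡⟨ cong (ℤ._+_ (f 0 ℤ.* g 0 ℤ.* h (suc n))) (trans (⊛-distribʳ (λ m → f 0 ℤ.* g (suc m)) (tail f ⊛ g) h n)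
         (cong₂ ℤ._+_ (⊛-scaleˡ (f 0) (tail g) h n) (⊛-assoc (tail f) g h n))) ⟩
  f 0 ℤ.* g 0 ℤ.* h (suc n) ℤ.+ (f 0 ℤ.* (tail g ⊛ h) n ℤ.+ (tail f ⊛ (g ⊛ h)) n)
    ≡⟨ regroup (f 0) (g 0) (h (suc n)) _ _ ⟩
  f 0 ℤ.* (g 0 ℤ.* h (suc n) ℤ.+ (tail g ⊛ h) n) ℤ.+ (tail f ⊛ (g ⊛ h)) n
    ≡⟨ cong (λ x → f 0 ℤ.* x ℤ.+ (tail f ⊛ (g ⊛ h)) n) (sym (⊛-suc g h n)) ⟩
  f 0 ℤ.* (g ⊛ h) (suc n) ℤ.+ (tail f ⊛ (g ⊛ h)) n
    ≡⟨ sym (⊛-suc f (g ⊛ h) n) ⟩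
  (f ⊛ (g ⊛ h)) (suc n) ∎
  where
  open ≡-Reasoning
  regroup : ∀ a b c x y → a ℤ.* b ℤ.* c ℤ.+ (a ℤ.* x ℤ.+ y) ≡ a ℤ.* (b ℤ.* c ℤ.+ x) ℤ.+ y
  regroup = ℤ-Solver.solve-∀

infix 4 _≈_
record _≈_ (f g : PS) : Set where
  constructor mk≈
  field coeff : f ≗ g
open _≈_ public

≈-refl : ∀ {f} → f ≈ f
≈-refl = mk≈ (λ _ → refl)

≈-sym : ∀ {f g} → f ≈ g → g ≈ f
≈-sym f≈g = mk≈ (λ n → sym (coeff f≈g n))

≈-trans : ∀ {f g h} → f ≈ g → g ≈ h → f ≈ h
≈-trans f≈g g≈h = mk≈ (λ n → trans (coeff f≈g n) (coeff g≈h n))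

≈-reflexive : ∀ {f g} → f ≡ g → f ≈ g
≈-reflexive refl = ≈-refl

infixl 6 _⊕_
infixl 7 _⊗_
infix  8 ⊖_

-- Opaque, so that unification treats these operations as rigid heads instead of unfolding them
-- to coefficient functions.
opaque
  _⊕_ : PS → PS → PS
  (f ⊕ g) n = f n ℤ.+ g n

  ⊖_ : PS → PS
  (⊖ f) n = ℤ.- f n

  _⊗_ : PS → PS → PS
  _⊗_ = _⊛_

  cst : ℤ → PS
  cst c zero    = c
  cst c (suc _) = + 0

  ⊕-coeff : ∀ f g n → (f ⊕ g) n ≡ f n ℤ.+ g n
  ⊕-coeff f g n = refl

  ⊖-coeff : ∀ f n → (⊖ f) n ≡ ℤ.- f n
  ⊖-coeff f n = refl

  ⊛≈⊗ : ∀ f g → f ⊛ g ≈ f ⊗ g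
  ⊛≈⊗ f g = ≈-refl

  cst-coeff-zero : ∀ c → cst c 0 ≡ c
  cst-coeff-zero c = refl

  cst-coeff-suc : ∀ c n → cst c (suc n) ≡ + 0
  cst-coeff-suc c n = refl

  ps-isCommutativeRing : IsCommutativeRing _≈_ _⊕_ _⊗_ ⊖_ (λ _ → + 0) one
  ps-isCommutativeRing = record
    { isRing = record
      { +-isAbelianGroup = record
        { isGroup = record
          { isMonoid = record
            { isSemigroup = record
              { isMagma = record
                { isEquivalence = record { refl = ≈-refl ; sym = ≈-sym ; trans = ≈-trans }
                ; ∙-cong = λ p q → mk≈ λ n → cong₂ ℤ._+_ (coeff p n) (coeff q n) }
              ; assoc = λ f g h → mk≈ λ n → ℤ.+-assoc (f n) (g n) (h n) }
            ; identity = (λ f → mk≈ λ n → ℤ.+-identityˡ (f n)) , (λ f → mk≈ λ n → ℤ.+-identityʳ (f n)) }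
          ; inverse = (λ f → mk≈ λ n → ℤ.+-inverseˡ (f n)) , (λ f → mk≈ λ n → ℤ.+-inverseʳ (f n))
          ; ⁻¹-cong = λ p → mk≈ λ n → cong ℤ.-_ (coeff p n) }
        ; comm = λ f g → mk≈ λ n → ℤ.+-comm (f n) (g n) }
      ; *-cong = λ p q → mk≈ (⊛-cong (coeff p) (coeff q))
      ; *-assoc = λ f g h → mk≈ (⊛-assoc f g h)
      ; *-identity = (λ f → mk≈ (⊛-identityˡ f))
                   , (λ f → mk≈ λ n → trans (⊛-comm f one n) (⊛-identityˡ f n))
      ; distrib = (λ f g h → mk≈ λ n → trans (⊛-comm f (g ⊕ h) n)
                     (trans (⊛-distribʳ g h f n) (cong₂ ℤ._+_ (⊛-comm g f n) (⊛-comm h f n))))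
                , (λ f g h → mk≈ (⊛-distribʳ g h f)) }
    ; *-comm = λ f g → mk≈ (⊛-comm f g) }

  cst-+ : ∀ a b → cst (a ℤ.+ b) ≈ cst a ⊕ cst b
  cst-+ a b = mk≈ λ { zero → refl ; (suc n) → refl }

  cst-* : ∀ a b → cst (a ℤ.* b) ≈ cst a ⊗ cst b
  cst-* a b = mk≈ λ
    { zero    → sym (⊛-zero (cst a) (cst b))
    ; (suc n) → sym (trans (⊛-suc (cst a) (cst b) n) (cong₂ ℤ._+_ (ℤ.*-zeroʳ a) (⊛-zeroˡ (cst b) n))) }

  cst-⊗-coeff : ∀ c f n → (cst c ⊗ f) n ≡ c ℤ.* f n
  cst-⊗-coeff c f zero    = ⊛-zero (cst c) f
  cst-⊗-coeff c f (suc n) = trans (⊛-suc (cst c) f n)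
    (trans (cong (ℤ._+_ (c ℤ.* f (suc n))) (⊛-zeroˡ f n)) (ℤ.+-identityʳ _))

  cst-‿ : ∀ a → cst (ℤ.- a) ≈ ⊖ cst a
  cst-‿ a = mk≈ λ { zero → refl ; (suc n) → refl }

  cst-0 : cst (+ 0) ≈ (λ _ → + 0)
  cst-0 = mk≈ λ { zero → refl ; (suc n) → refl }

  cst-1 : cst (+ 1) ≈ one
  cst-1 = mk≈ λ { zero → refl ; (suc n) → refl }

ps-commutativeRing : CommutativeRing 0ℓ 0ℓ
ps-commutativeRing = record { isCommutativeRing = ps-isCommutativeRing }

cst-morphism : ℤ.+-*-rawRing ACR.-Raw-AlmostCommutative⟶ ACR.fromCommutativeRing ps-commutativeRing
cst-morphism = record
  { ⟦_⟧ = cst ; +-homo = cst-+ ; *-homo = cst-* ; -‿homo = cst-‿ ; 0-homo = cst-0 ; 1-homo = cst-1 }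

cst-≟ : ∀ a b → Maybe (cst a ≈ cst b)
cst-≟ a b with a ℤ.≟ b
... | yes refl = just ≈-refl
... | no _     = nothing

open import Algebra.Solver.Ring ℤ.+-*-rawRing (ACR.fromCommutativeRing ps-commutativeRing) cst-morphism cst-≟
  using (solve; _:=_; con; _:+_; _:*_; :-_)

module ≈-Reasoning = Relation.Binary.Reasoning.Setoid (CommutativeRing.setoid ps-commutativeRing)

𝟎 𝟏 𝟐 : PS
𝟎 = cst (+ 0)
𝟏 = cst (+ 1)
𝟐 = cst (+ 2)

open CommutativeRing ps-commutativeRing public using ()
  renaming ( +-cong to infixl 6 _⟨⊕⟩_; *-cong to infixl 7 _⟨⊗⟩_; -‿cong to ⟨⊖⟩
           ; *-comm to ⊗-comm; *-assoc to ⊗-assoc)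

⊗-identityˡ : ∀ f → 𝟏 ⊗ f ≈ f
⊗-identityˡ = solve 1 (λ f → con (+ 1) :* f := f) ≈-refl

⊛-cong-⊗ : ∀ {f f′ g g′} → f ≈ f′ → g ≈ g′ → f ⊛ g ≈ f′ ⊗ g′
⊛-cong-⊗ {f} {f′} {g} {g′} f≈f′ g≈g′ = ≈-trans (⊛≈⊗ f g) (f≈f′ ⟨⊗⟩ g≈g′)

⊗-identityʳ : ∀ f → f ⊗ 𝟏 ≈ f
⊗-identityʳ = solve 1 (λ f → f :* con (+ 1) := f) ≈-refl

⊗-coeff-zero : ∀ f g → (f ⊗ g) 0 ≡ f 0 ℤ.* g 0
⊗-coeff-zero f g = trans (sym (coeff (⊛≈⊗ f g) 0)) (⊛-zero f g)

⊗-zeroʳ : ∀ f → f ⊗ 𝟎 ≈ 𝟎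
⊗-zeroʳ = solve 1 (λ f → f :* con (+ 0) := con (+ 0)) ≈-refl

shift : ℕ → PS → PS
shift zero    f         = f
shift (suc m) f zero    = + 0
shift (suc m) f (suc n) = shift m f n

shift-< : ∀ {m n} f → n < m → shift m f n ≡ + 0
shift-< {suc m} {zero}  f _         = refl
shift-< {suc m} {suc n} f (s≤s n<m) = shift-< f n<m

shift-+ : ∀ m f t → shift m f (m + t) ≡ f t
shift-+ zero    f t = refl
shift-+ (suc m) f t = shift-+ m f t

infix 8 q^_
opaque
  q^_ : ℕ → PS
  (q^ zero)  zero    = + 1
  (q^ zero)  (suc n) = + 0
  (q^ suc m) zero    = + 0
  (q^ suc m) (suc n) = (q^ m) n

  q^-coeff-≡ : ∀ m → (q^ m) m ≡ + 1
  q^-coeff-≡ zero    = refl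
  q^-coeff-≡ (suc m) = q^-coeff-≡ m

  q^-coeff-≢ : ∀ {m n} → n ≢ m → (q^ m) n ≡ + 0
  q^-coeff-≢ {zero}  {zero}  n≢m = contradiction refl n≢m
  q^-coeff-≢ {zero}  {suc n} n≢m = refl
  q^-coeff-≢ {suc m} {zero}  n≢m = refl
  q^-coeff-≢ {suc m} {suc n} n≢m = q^-coeff-≢ (n≢m ∘ cong suc)

  q^0 : q^ 0 ≈ 𝟏
  q^0 = mk≈ λ n → trans (q^0≗one n) (sym (coeff cst-1 n))
    where
    q^0≗one : q^ 0 ≗ one
    q^0≗one zero    = refl
    q^0≗one (suc n) = refl

  q^-⊗ : ∀ m f → q^ m ⊗ f ≈ shift m f
  q^-⊗ m f = ≈-trans (≈-sym (⊛≈⊗ (q^ m) f)) (mk≈ (q^-⊛ m))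
    where
    q^-⊛ : ∀ m → q^ m ⊛ f ≗ shift m f
    q^-⊛ zero            = coeff (≈-trans (⊛≈⊗ (q^ 0) f) (≈-trans (q^0 ⟨⊗⟩ ≈-refl) (⊗-identityˡ f)))
    q^-⊛ (suc m) zero    = ⊛-zero (q^ suc m) f
    q^-⊛ (suc m) (suc n) = trans (⊛-suc (q^ suc m) f n) (trans (ℤ.+-identityˡ _) (q^-⊛ m n))

  q^-+ : ∀ a b → q^ a ⊗ q^ b ≈ q^ (a + b)
  q^-+ a b = ≈-trans (q^-⊗ a (q^ b)) (mk≈ (shift-q^ a))
    where
    shift-q^ : ∀ a → shift a (q^ b) ≗ q^ (a + b)
    shift-q^ zero    n       = refl
    shift-q^ (suc a) zero    = refl
    shift-q^ (suc a) (suc n) = shift-q^ a n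

q^-coeff-< : ∀ {m n} → n < m → (q^ m) n ≡ + 0
q^-coeff-< n<m = q^-coeff-≢ (ℕ.<⇒≢ n<m)

q^-⊗-cong : ∀ {a b a′ b′} → a + b ≡ a′ + b′ → q^ a ⊗ q^ b ≈ q^ a′ ⊗ q^ b′
q^-⊗-cong {a} {b} {a′} {b′} eq =
  ≈-trans (q^-+ a b) (≈-trans (≈-reflexive (cong q^_ eq)) (≈-sym (q^-+ a′ b′)))

-- Congruence modulo q^M

infix 4 _≈[_]_
record _≈[_]_ (f : PS) (M : ℕ) (g : PS) : Set where
  constructor mk≈[]
  field coeff< : ∀ {n} → n < M → f n ≡ g n
open _≈[_]_ public

≈⇒≈[] : ∀ {M f g} → f ≈ g → f ≈[ M ] g
≈⇒≈[] f≈g = mk≈[] λ {n} _ → coeff f≈g n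

≈[]-refl : ∀ {M f} → f ≈[ M ] f
≈[]-refl = mk≈[] λ _ → refl

≈[]-sym : ∀ {M f g} → f ≈[ M ] g → g ≈[ M ] f
≈[]-sym f≈g = mk≈[] λ n<M → sym (coeff< f≈g n<M)

≈[]-trans : ∀ {M f g h} → f ≈[ M ] g → g ≈[ M ] h → f ≈[ M ] h
≈[]-trans f≈g g≈h = mk≈[] λ n<M → trans (coeff< f≈g n<M) (coeff< g≈h n<M)

≈[]-setoid : ℕ → Setoid 0ℓ 0ℓ
≈[]-setoid M = record
  { Carrier = PS
  ; _≈_ = _≈[ M ]_
  ; isEquivalence = record { refl = ≈[]-refl ; sym = ≈[]-sym ; trans = ≈[]-trans } }

module ≈[]-Reasoning (M : ℕ) = Relation.Binary.Reasoning.Setoid (≈[]-setoid M)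

≈[]-weaken : ∀ {M M′ f g} → M′ ≤ M → f ≈[ M ] g → f ≈[ M′ ] g
≈[]-weaken M′≤M f≈g = mk≈[] λ n<M′ → coeff< f≈g (ℕ.<-≤-trans n<M′ M′≤M)

≈[]-⊕ : ∀ {M f f′ g g′} → f ≈[ M ] f′ → g ≈[ M ] g′ → f ⊕ g ≈[ M ] f′ ⊕ g′
≈[]-⊕ {f = f} {f′} {g} {g′} f≈f′ g≈g′ = mk≈[] λ {n} n<M →
  trans (⊕-coeff f g n) (trans (cong₂ ℤ._+_ (coeff< f≈f′ n<M) (coeff< g≈g′ n<M)) (sym (⊕-coeff f′ g′ n)))

≈[]-⊖ : ∀ {M f f′} → f ≈[ M ] f′ → ⊖ f ≈[ M ] ⊖ f′
≈[]-⊖ {f = f} {f′} f≈f′ = mk≈[] λ {n} n<M →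
  trans (⊖-coeff f n) (trans (cong ℤ.-_ (coeff< f≈f′ n<M)) (sym (⊖-coeff f′ n)))

⊛-cong-< : ∀ {M f f′ g g′} → f ≈[ M ] f′ → g ≈[ M ] g′ → ∀ {n} → n < M → (f ⊛ g) n ≡ (f′ ⊛ g′) n
⊛-cong-< f≈f′ g≈g′ {n} n<M = cong sumℤ (map-cong-local (applyUpTo⁺₁ id (suc n) λ {k} k<1+n →
  cong₂ ℤ._*_ (coeff< f≈f′ (ℕ.<-≤-trans k<1+n n<M)) (coeff< g≈g′ (ℕ.≤-<-trans (ℕ.m∸n≤m n k) n<M))))

≈[]-⊗ : ∀ {M f f′ g g′} → f ≈[ M ] f′ → g ≈[ M ] g′ → f ⊗ g ≈[ M ] f′ ⊗ g′
≈[]-⊗ {f = f} {f′} {g} {g′} f≈f′ g≈g′ = mk≈[] λ {n} n<M →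
  trans (sym (coeff (⊛≈⊗ f g) n)) (trans (⊛-cong-< f≈f′ g≈g′ n<M) (coeff (⊛≈⊗ f′ g′) n))

q^-≈[]-𝟎 : ∀ {M m} → M ≤ m → q^ m ≈[ M ] 𝟎
q^-≈[]-𝟎 M≤m = mk≈[] λ {n} n<M → trans (q^-coeff-< (ℕ.<-≤-trans n<M M≤m)) (sym (coeff cst-0 n))

q^-⊗-≈[] : ∀ m {M f g} → f ≈[ M ] g → q^ m ⊗ f ≈[ m + M ] q^ m ⊗ g
q^-⊗-≈[] m {f = f} {g} f≈g =
  ≈[]-trans (≈⇒≈[] (q^-⊗ m f)) (≈[]-trans (shift-≈[] m) (≈⇒≈[] (≈-sym (q^-⊗ m g))))
  where
  shift-≈[] : ∀ m → shift m f ≈[ m + _ ] shift m g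
  shift-≈[] zero    = f≈g
  shift-≈[] (suc m) = mk≈[] λ { {zero} _ → refl ; {suc n} (s≤s n<m+M) → coeff< (shift-≈[] m) n<m+M }

𝟏⊕-≈[]-𝟏 : ∀ {M f} → f ≈[ M ] 𝟎 → 𝟏 ⊕ f ≈[ M ] 𝟏
𝟏⊕-≈[]-𝟏 f≈𝟎 = ≈[]-trans (≈[]-⊕ ≈[]-refl f≈𝟎) (≈⇒≈[] (solve 0 (con (+ 1) :+ con (+ 0) := con (+ 1)) ≈-refl))

⊖-≈[]-𝟎 : ∀ {M f} → f ≈[ M ] 𝟎 → ⊖ f ≈[ M ] 𝟎
⊖-≈[]-𝟎 f≈𝟎 = ≈[]-trans (≈[]-⊖ f≈𝟎) (≈⇒≈[] (solve 0 (:- con (+ 0) := con (+ 0)) ≈-refl))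

⊗-≈[]-𝟎 : ∀ {M f} g → f ≈[ M ] 𝟎 → g ⊗ f ≈[ M ] 𝟎
⊗-≈[]-𝟎 g f≈𝟎 = ≈[]-trans (≈[]-⊗ (≈[]-refl {f = g}) f≈𝟎) (≈⇒≈[] (⊗-zeroʳ g))

⊗-≈[]-𝟏 : ∀ {M f g} → f ≈[ M ] 𝟏 → g ≈[ M ] 𝟏 → f ⊗ g ≈[ M ] 𝟏
⊗-≈[]-𝟏 f≈𝟏 g≈𝟏 = ≈[]-trans (≈[]-⊗ f≈𝟏 g≈𝟏) (≈⇒≈[] (⊗-identityˡ 𝟏))

⊛-cancelʳ-coeff : ∀ {M a b} c → c 0 ≡ + 1 → a ≈[ M ] b → (a ⊛ c) M ≡ (b ⊛ c) M → a M ≡ b M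
⊛-cancelʳ-coeff {zero} {a} {b} c c₀≡1 _ eq = begin
  a 0                ≡⟨ sym (*c₀ (a 0)) ⟩
  a 0 ℤ.* c 0        ≡⟨ sym (⊛-zero a c) ⟩
  (a ⊛ c) 0          ≡⟨ eq ⟩
  (b ⊛ c) 0          ≡⟨ ⊛-zero b c ⟩
  b 0 ℤ.* c 0        ≡⟨ *c₀ (b 0) ⟩
  b 0                ∎
  where
  open ≡-Reasoning
  *c₀ : ∀ x → x ℤ.* c 0 ≡ x
  *c₀ x = trans (cong (x ℤ.*_) c₀≡1) (ℤ.*-identityʳ x)
⊛-cancelʳ-coeff {suc m} {a} {b} c c₀≡1 a≈b eq = begin
  a (suc m)             ≡⟨ sym (*c₀ (a (suc m))) ⟩
  a (suc m) ℤ.* c 0     ≡⟨ ∙-cancelˡ ((a ⊛ tail c) m) _ _ (begin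
      (a ⊛ tail c) m ℤ.+ a (suc m) ℤ.* c 0   ≡⟨ sym (⊛-sucʳ a c m) ⟩
      (a ⊛ c) (suc m)                         ≡⟨ eq ⟩
      (b ⊛ c) (suc m)                         ≡⟨ ⊛-sucʳ b c m ⟩
      (b ⊛ tail c) m ℤ.+ b (suc m) ℤ.* c 0   ≡⟨ cong (ℤ._+ b (suc m) ℤ.* c 0) (sym lower) ⟩
      (a ⊛ tail c) m ℤ.+ b (suc m) ℤ.* c 0   ∎) ⟩
  b (suc m) ℤ.* c 0     ≡⟨ *c₀ (b (suc m)) ⟩
  b (suc m)             ∎
  where
  open ≡-Reasoning
  *c₀ : ∀ x → x ℤ.* c 0 ≡ x
  *c₀ x = trans (cong (x ℤ.*_) c₀≡1) (ℤ.*-identityʳ x)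
  lower : (a ⊛ tail c) m ≡ (b ⊛ tail c) m
  lower = ⊛-cong-< a≈b (≈[]-refl {f = tail c}) (ℕ.n<1+n m)

⊗-cancelʳ-≈[] : ∀ {M a b} c → c 0 ≡ + 1 → a ⊗ c ≈[ M ] b ⊗ c → a ≈[ M ] b
⊗-cancelʳ-≈[] {M} {a} {b} c c₀≡1 ac≈bc = cancel M ℕ.≤-refl
  where
  ac≈bc′ : a ⊛ c ≈[ M ] b ⊛ c
  ac≈bc′ = ≈[]-trans (≈⇒≈[] (⊛≈⊗ a c)) (≈[]-trans ac≈bc (≈⇒≈[] (≈-sym (⊛≈⊗ b c))))
  cancel : ∀ N → N ≤ M → a ≈[ N ] b
  cancel zero    _     = mk≈[] λ ()
  cancel (suc N) N<M = mk≈[] λ n<1+N → [ coeff< below , (λ { refl → top }) ]′ (ℕ.m<1+n⇒m<n∨m≡n n<1+N)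
    where
    below = cancel N (ℕ.<⇒≤ N<M)
    top = ⊛-cancelʳ-coeff c c₀≡1 below (coeff< ac≈bc′ N<M)

⊗-cancelʳ : ∀ {a b} c → c 0 ≡ + 1 → a ⊗ c ≈ b ⊗ c → a ≈ b
⊗-cancelʳ c c₀≡1 ac≈bc = mk≈ λ n → coeff< (⊗-cancelʳ-≈[] c c₀≡1 (≈⇒≈[] ac≈bc)) (ℕ.n<1+n n)

-- Finite sums and products

∑ : ℕ → (ℕ → PS) → PS
∑ zero    f = 𝟎
∑ (suc K) f = ∑ K f ⊕ f K

syntax ∑ K (λ i → f) = ∑[ i < K ] f

∑-cong : ∀ K {f g} → (∀ i → i < K → f i ≈ g i) → ∑ K f ≈ ∑ K g
∑-cong zero    f≈g = ≈-refl
∑-cong (suc K) f≈g = ∑-cong K (λ i i<K → f≈g i (ℕ.m<n⇒m<1+n i<K)) ⟨⊕⟩ f≈g K (ℕ.n<1+n K)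

∑-cong-≈[] : ∀ K {M f g} → (∀ i → i < K → f i ≈[ M ] g i) → ∑ K f ≈[ M ] ∑ K g
∑-cong-≈[] zero    f≈g = ≈[]-refl
∑-cong-≈[] (suc K) f≈g =
  ≈[]-⊕ (∑-cong-≈[] K (λ i i<K → f≈g i (ℕ.m<n⇒m<1+n i<K))) (f≈g K (ℕ.n<1+n K))

∑-⊕ : ∀ K f g → ∑[ i < K ] (f i ⊕ g i) ≈ ∑ K f ⊕ ∑ K g
∑-⊕ zero    f g = solve 0 (con (+ 0) := con (+ 0) :+ con (+ 0)) ≈-refl
∑-⊕ (suc K) f g = ≈-trans (∑-⊕ K f g ⟨⊕⟩ ≈-refl)
  (solve 4 (λ a b c d → a :+ b :+ (c :+ d) := a :+ c :+ (b :+ d)) ≈-refl (∑ K f) (∑ K g) (f K) (g K))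

∑-distribˡ : ∀ K g f → ∑[ i < K ] (g ⊗ f i) ≈ g ⊗ ∑ K f
∑-distribˡ zero    g f = solve 1 (λ g → con (+ 0) := g :* con (+ 0)) ≈-refl g
∑-distribˡ (suc K) g f = ≈-trans (∑-distribˡ K g f ⟨⊕⟩ ≈-refl)
  (solve 3 (λ g s a → g :* s :+ g :* a := g :* (s :+ a)) ≈-refl g (∑ K f) (f K))

∑-head : ∀ K f → ∑ (suc K) f ≈ f 0 ⊕ ∑[ i < K ] f (suc i)
∑-head zero    f = solve 1 (λ a → con (+ 0) :+ a := a :+ con (+ 0)) ≈-refl (f 0)
∑-head (suc K) f = ≈-trans (∑-head K f ⟨⊕⟩ ≈-refl)
  (solve 3 (λ a s b → a :+ s :+ b := a :+ (s :+ b)) ≈-refl (f 0) (∑[ i < K ] f (suc i)) (f (suc K)))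

∑-last-𝟎 : ∀ K f → f K ≈ 𝟎 → ∑ (suc K) f ≈ ∑ K f
∑-last-𝟎 K f fK≈𝟎 = ≈-trans (≈-refl ⟨⊕⟩ fK≈𝟎) (solve 1 (λ s → s :+ con (+ 0) := s) ≈-refl (∑ K f))

∑-square : ∀ L f →
  ∑ L f ⊗ ∑ L f ≈ ∑[ i < L ] (f i ⊗ f i) ⊕ 𝟐 ⊗ ∑[ i < L ] ∑[ j < i ] (f i ⊗ f j)
∑-square zero    f = solve 0 (con (+ 0) :* con (+ 0) := con (+ 0) :+ con (+ 2) :* con (+ 0)) ≈-refl
∑-square (suc L) f = begin
  (S ⊕ a) ⊗ (S ⊕ a)                  ≈⟨ solve 2 (λ S a → (S :+ a) :* (S :+ a)
                                             := S :* S :+ con (+ 2) :* (a :* S) :+ a :* a) ≈-refl S a ⟩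
  S ⊗ S ⊕ 𝟐 ⊗ (a ⊗ S) ⊕ a ⊗ a        ≈⟨ ∑-square L f ⟨⊕⟩ ≈-refl ⟨⊗⟩ ≈-sym (∑-distribˡ L a f) ⟨⊕⟩ ≈-refl ⟩
  D ⊕ 𝟐 ⊗ O ⊕ 𝟐 ⊗ Oₐ ⊕ a ⊗ a         ≈⟨ solve 4 (λ D O Oₐ aa → D :+ con (+ 2) :* O :+ con (+ 2) :* Oₐ :+ aa
                                             := D :+ aa :+ con (+ 2) :* (O :+ Oₐ)) ≈-refl D O Oₐ (a ⊗ a) ⟩
  D ⊕ a ⊗ a ⊕ 𝟐 ⊗ (O ⊕ Oₐ)           ∎
  where
  open ≈-Reasoning
  S = ∑ L f
  a = f L
  D = ∑[ i < L ] (f i ⊗ f i)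
  O = ∑[ i < L ] ∑[ j < i ] (f i ⊗ f j)
  Oₐ = ∑[ j < L ] (a ⊗ f j)

∏ : ℕ → (ℕ → PS) → PS
∏ zero    f = 𝟏
∏ (suc K) f = ∏ K f ⊗ f K

syntax ∏ K (λ k → f) = ∏[ k < K ] f

∏-cong : ∀ K {f g} → (∀ k → f k ≈ g k) → ∏ K f ≈ ∏ K g
∏-cong zero    f≈g = ≈-refl
∏-cong (suc K) f≈g = ∏-cong K f≈g ⟨⊗⟩ f≈g K

∏-⊗ : ∀ K f g → ∏[ k < K ] (f k ⊗ g k) ≈ ∏ K f ⊗ ∏ K g
∏-⊗ zero    f g = solve 0 (con (+ 1) := con (+ 1) :* con (+ 1)) ≈-refl
∏-⊗ (suc K) f g = ≈-trans (∏-⊗ K f g ⟨⊗⟩ ≈-refl)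
  (solve 4 (λ F G a b → F :* G :* (a :* b) := F :* a :* (G :* b)) ≈-refl (∏ K f) (∏ K g) (f K) (g K))

∏-even-odd : ∀ K f → ∏ (K + K) f ≈ ∏[ k < K ] (f (k + k) ⊗ f (suc (k + k)))
∏-even-odd zero    f = ≈-refl
∏-even-odd (suc K) f = begin
  ∏ (suc K + suc K) f                          ≡⟨ cong (λ n → ∏ n f) (ℕ.+-suc (suc K) K) ⟩
  ∏ (K + K) f ⊗ f (K + K) ⊗ f (suc (K + K))    ≈⟨ ⊗-assoc _ _ _ ⟩
  ∏ (K + K) f ⊗ (f (K + K) ⊗ f (suc (K + K)))  ≈⟨ ∏-even-odd K f ⟨⊗⟩ ≈-refl ⟩
  ∏[ k < suc K ] (f (k + k) ⊗ f (suc (k + k))) ∎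
  where open ≈-Reasoning

∏-stable : ∀ {M m n} f → (∀ k → m ≤ k → f k ≈[ M ] 𝟏) → m ≤ n → ∏ n f ≈[ M ] ∏ m f
∏-stable {m = m} {n} f f≈𝟏 m≤n with ℕ.m≤n⇒m<n∨m≡n m≤n
... | inj₂ refl = ≈[]-refl
... | inj₁ (s≤s {n = n′} m≤n′) =
  ≈[]-trans (≈[]-⊗ (∏-stable f f≈𝟏 m≤n′) (f≈𝟏 n′ m≤n′)) (≈⇒≈[] (⊗-identityʳ (∏ m f)))

module QBinomial (e : ℕ) {{_ : NonZero e}} where

  infix 8 Q^_
  Q^_ : ℕ → PS
  Q^ i = q^ (e * i)

  Q^-+ : ∀ a b → Q^ a ⊗ Q^ b ≈ Q^ (a + b)
  Q^-+ a b = ≈-trans (q^-+ (e * a) (e * b)) (≈-reflexive (cong q^_ (sym (ℕ.*-distribˡ-+ e a b))))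

  Q^0 : Q^ 0 ≈ 𝟏
  Q^0 = ≈-trans (≈-reflexive (cong q^_ (ℕ.*-zeroʳ e))) q^0

  qPoch : ℕ → PS
  qPoch n = ∏[ i < n ] (𝟏 ⊕ ⊖ Q^ suc i)

  qPoch-stable : ∀ {m n} → m ≤ n → qPoch n ≈[ e * suc m ] qPoch m
  qPoch-stable = ∏-stable _ λ k m≤k → 𝟏⊕-≈[]-𝟏 (⊖-≈[]-𝟎 (q^-≈[]-𝟎 (ℕ.*-monoʳ-≤ e (s≤s m≤k))))

  qPoch-coeff-zero : ∀ n → qPoch n 0 ≡ + 1
  qPoch-coeff-zero n =
    trans (coeff< (qPoch-stable {n = n} z≤n) (ℕ.≤-trans (N.>-nonZero⁻¹ e) (ℕ.m≤m*n e 1))) (cst-coeff-zero (+ 1))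

  qbinom : ℕ → ℕ → PS
  qbinom n       zero    = 𝟏
  qbinom zero    (suc k) = 𝟎
  qbinom (suc n) (suc k) = qbinom n k ⊕ Q^ suc k ⊗ qbinom n (suc k)

  qbinom-cong : ∀ {n n′ k k′} → n ≡ n′ → k ≡ k′ → qbinom n k ≈ qbinom n′ k′
  qbinom-cong refl refl = ≈-refl

  qbinom-congˡ : ∀ k {n n′} → n ≡ n′ → qbinom n k ≈ qbinom n′ k
  qbinom-congˡ k refl = ≈-refl

  qbinom-vanish : ∀ {n k} → n < k → qbinom n k ≈ 𝟎
  qbinom-vanish {zero}  {suc k} _         = ≈-refl
  qbinom-vanish {suc n} {suc k} (s≤s n<k) =
    ≈-trans (qbinom-vanish n<k ⟨⊕⟩ ≈-refl ⟨⊗⟩ qbinom-vanish (ℕ.m<n⇒m<1+n n<k))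
      (solve 1 (λ a → con (+ 0) :+ a :* con (+ 0) := con (+ 0)) ≈-refl (Q^ suc k))

  qbinom-diag : ∀ n → qbinom n n ≈ 𝟏
  qbinom-diag zero    = ≈-refl
  qbinom-diag (suc n) = ≈-trans (qbinom-diag n ⟨⊕⟩ ≈-refl ⟨⊗⟩ qbinom-vanish (ℕ.n<1+n n))
    (solve 1 (λ a → con (+ 1) :+ a :* con (+ 0) := con (+ 1)) ≈-refl (Q^ suc n))

  qbinom-qPoch : ∀ k r → qbinom (k + r) k ⊗ qPoch k ⊗ qPoch r ≈ qPoch (k + r)
  qbinom-qPoch zero r = solve 1 (λ p → con (+ 1) :* con (+ 1) :* p := p) ≈-refl (qPoch r)
  qbinom-qPoch (suc k) zero = begin
    qbinom (suc k + 0) (suc k) ⊗ qPoch (suc k) ⊗ 𝟏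
      ≈⟨ ≈-trans (qbinom-congˡ (suc k) (ℕ.+-identityʳ (suc k))) (qbinom-diag (suc k)) ⟨⊗⟩ ≈-refl ⟨⊗⟩ ≈-refl ⟩
    𝟏 ⊗ qPoch (suc k) ⊗ 𝟏
      ≈⟨ solve 1 (λ p → con (+ 1) :* p :* con (+ 1) := p) ≈-refl (qPoch (suc k)) ⟩
    qPoch (suc k)
      ≈⟨ ≈-reflexive (cong qPoch (sym (ℕ.+-identityʳ (suc k)))) ⟩
    qPoch (suc k + 0) ∎
    where open ≈-Reasoning
  qbinom-qPoch (suc k) (suc r) = begin
    (qbinom n k ⊕ Q^ suc k ⊗ qbinom n (suc k)) ⊗ (qPoch k ⊗ 𝟏⊖Q^ (suc k)) ⊗ (qPoch r ⊗ 𝟏⊖Q^ (suc r))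
      ≈⟨ expand (qbinom n k) (Q^ suc k) (qbinom n (suc k)) (qPoch k) (𝟏⊖Q^ (suc k)) (qPoch r) (𝟏⊖Q^ (suc r)) ⟩
    qbinom n k ⊗ qPoch k ⊗ qPoch (suc r) ⊗ 𝟏⊖Q^ (suc k)
      ⊕ Q^ suc k ⊗ (qbinom n (suc k) ⊗ qPoch (suc k) ⊗ qPoch r) ⊗ 𝟏⊖Q^ (suc r)
      ≈⟨ qbinom-qPoch k (suc r) ⟨⊗⟩ ≈-refl
         ⟨⊕⟩ ≈-refl ⟨⊗⟩ ≈-trans (qbinom-congˡ (suc k) (ℕ.+-suc k r) ⟨⊗⟩ ≈-refl ⟨⊗⟩ ≈-refl) (qbinom-qPoch (suc k) r)
               ⟨⊗⟩ ≈-refl ⟩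
    qPoch n ⊗ 𝟏⊖Q^ (suc k) ⊕ Q^ suc k ⊗ qPoch (suc k + r) ⊗ 𝟏⊖Q^ (suc r)
      ≈⟨ ≈-refl ⟨⊕⟩ ≈-refl ⟨⊗⟩ ≈-reflexive (cong qPoch (sym (ℕ.+-suc k r))) ⟨⊗⟩ ≈-refl ⟩
    qPoch n ⊗ 𝟏⊖Q^ (suc k) ⊕ Q^ suc k ⊗ qPoch n ⊗ 𝟏⊖Q^ (suc r)
      ≈⟨ collect (qPoch n) (Q^ suc k) (Q^ suc r) ⟩
    qPoch n ⊗ (𝟏 ⊕ ⊖ (Q^ suc k ⊗ Q^ suc r))
      ≈⟨ ≈-refl ⟨⊗⟩ (≈-refl ⟨⊕⟩ ⟨⊖⟩ (Q^-+ (suc k) (suc r))) ⟩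
    qPoch (suc k + suc r) ∎
    where
    open ≈-Reasoning
    n = k + suc r
    𝟏⊖Q^ : ℕ → PS
    𝟏⊖Q^ i = 𝟏 ⊕ ⊖ Q^ i
    expand : ∀ g₁ a g₂ p o p′ o′ → (g₁ ⊕ a ⊗ g₂) ⊗ (p ⊗ o) ⊗ (p′ ⊗ o′)
                                   ≈ g₁ ⊗ p ⊗ (p′ ⊗ o′) ⊗ o ⊕ a ⊗ (g₂ ⊗ (p ⊗ o) ⊗ p′) ⊗ o′
    expand = solve 7 (λ g₁ a g₂ p o p′ o′ → (g₁ :+ a :* g₂) :* (p :* o) :* (p′ :* o′)
                        := g₁ :* p :* (p′ :* o′) :* o :+ a :* (g₂ :* (p :* o) :* p′) :* o′) ≈-refl
    collect : ∀ p a b → p ⊗ (𝟏 ⊕ ⊖ a) ⊕ a ⊗ p ⊗ (𝟏 ⊕ ⊖ b) ≈ p ⊗ (𝟏 ⊕ ⊖ (a ⊗ b))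
    collect = solve 3 (λ p a b → p :* (con (+ 1) :+ :- a) :+ a :* p :* (con (+ 1) :+ :- b)
                         := p :* (con (+ 1) :+ :- (a :* b))) ≈-refl

  qbinom-sym : ∀ k r → qbinom (k + r) k ≈ qbinom (k + r) r
  qbinom-sym k r = ⊗-cancelʳ (qPoch k ⊗ qPoch r) constant-term (begin
    qbinom (k + r) k ⊗ (qPoch k ⊗ qPoch r)   ≈⟨ ≈-sym (⊗-assoc (qbinom (k + r) k) (qPoch k) (qPoch r)) ⟩
    qbinom (k + r) k ⊗ qPoch k ⊗ qPoch r     ≈⟨ qbinom-qPoch k r ⟩
    qPoch (k + r)                            ≈⟨ ≈-reflexive (cong qPoch (ℕ.+-comm k r)) ⟩
    qPoch (r + k)                            ≈⟨ ≈-sym (qbinom-qPoch r k) ⟩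
    qbinom (r + k) r ⊗ qPoch r ⊗ qPoch k     ≈⟨ qbinom-congˡ r (ℕ.+-comm r k) ⟨⊗⟩ ≈-refl ⟨⊗⟩ ≈-refl ⟩
    qbinom (k + r) r ⊗ qPoch r ⊗ qPoch k     ≈⟨ solve 3 (λ a b c → a :* b :* c := a :* (c :* b)) ≈-refl
                                                   (qbinom (k + r) r) (qPoch r) (qPoch k) ⟩
    qbinom (k + r) r ⊗ (qPoch k ⊗ qPoch r)   ∎)
    where
    open ≈-Reasoning
    constant-term : (qPoch k ⊗ qPoch r) 0 ≡ + 1
    constant-term = trans (⊗-coeff-zero (qPoch k) (qPoch r))
                          (cong₂ ℤ._*_ (qPoch-coeff-zero k) (qPoch-coeff-zero r))

  qbinom-qPoch-≈[] : ∀ k r → qbinom (k + r) k ⊗ qPoch k ≈[ e * suc r ] 𝟏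
  qbinom-qPoch-≈[] k r = ⊗-cancelʳ-≈[] (qPoch r) (qPoch-coeff-zero r) (begin
    qbinom (k + r) k ⊗ qPoch k ⊗ qPoch r   ≈⟨ ≈⇒≈[] (qbinom-qPoch k r) ⟩
    qPoch (k + r)                          ≈⟨ qPoch-stable (ℕ.m≤n+m r k) ⟩
    qPoch r                                ≈⟨ ≈⇒≈[] (≈-sym (⊗-identityˡ (qPoch r))) ⟩
    𝟏 ⊗ qPoch r                            ∎)
    where open ≈[]-Reasoning (e * suc r)

  qbinom-pascal′ : ∀ k r → qbinom (suc (k + r)) (suc k) ≈ Q^ r ⊗ qbinom (k + r) k ⊕ qbinom (k + r) (suc k)
  qbinom-pascal′ k zero = begin
    qbinom (k + 0) k ⊕ Q^ suc k ⊗ qbinom (k + 0) (suc k)   ≈⟨ ≈-refl ⟨⊕⟩ ≈-refl ⟨⊗⟩ vanish ⟩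
    qbinom (k + 0) k ⊕ Q^ suc k ⊗ 𝟎                        ≈⟨ solve 2 (λ g a → g :+ a :* con (+ 0)
                                                                 := con (+ 1) :* g :+ con (+ 0)) ≈-refl
                                                                 (qbinom (k + 0) k) (Q^ suc k) ⟩
    𝟏 ⊗ qbinom (k + 0) k ⊕ 𝟎                               ≈⟨ ≈-sym Q^0 ⟨⊗⟩ ≈-refl ⟨⊕⟩ ≈-sym vanish ⟩
    Q^ 0 ⊗ qbinom (k + 0) k ⊕ qbinom (k + 0) (suc k)       ∎
    where
    open ≈-Reasoning
    vanish : qbinom (k + 0) (suc k) ≈ 𝟎
    vanish = qbinom-vanish (s≤s (ℕ.≤-reflexive (ℕ.+-identityʳ k)))
  qbinom-pascal′ k (suc r) = begin
    qbinom (suc n) (suc k)                           ≈⟨ qbinom-sym (suc k) (suc r) ⟩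
    qbinom n r ⊕ Q^ suc r ⊗ qbinom n (suc r)         ≈⟨ sym-r ⟨⊕⟩ ≈-refl ⟨⊗⟩ ≈-sym (qbinom-sym k (suc r)) ⟩
    qbinom n (suc k) ⊕ Q^ suc r ⊗ qbinom n k         ≈⟨ solve 3 (λ a b c → a :+ b :* c := b :* c :+ a) ≈-refl
                                                          (qbinom n (suc k)) (Q^ suc r) (qbinom n k) ⟩
    Q^ suc r ⊗ qbinom n k ⊕ qbinom n (suc k)         ∎
    where
    open ≈-Reasoning
    n = k + suc r
    sym-r : qbinom n r ≈ qbinom n (suc k)
    sym-r = ≈-trans (qbinom-congˡ r (ℕ.+-suc k r))
              (≈-trans (≈-sym (qbinom-sym (suc k) r)) (qbinom-congˡ (suc k) (sym (ℕ.+-suc k r))))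

  qbinom-suc-suc : ∀ k r →
    qbinom (suc (suc (k + r))) (suc (suc k)) ≈
      (𝟏 ⊕ Q^ suc (k + r)) ⊗ qbinom (k + r) (suc k) ⊕ Q^ r ⊗ qbinom (k + r) k
      ⊕ Q^ suc (suc k) ⊗ qbinom (k + r) (suc (suc k))
  qbinom-suc-suc k zero = begin
    qbinom (suc n) (suc k) ⊕ Q^ suc (suc k) ⊗ qbinom (suc n) (suc (suc k))
      ≈⟨ qbinom-pascal′ k 0 ⟨⊕⟩ ≈-refl ⟨⊗⟩ qbinom-vanish (s≤s (s≤s n≤k)) ⟩
    Q^ 0 ⊗ qbinom n k ⊕ qbinom n (suc k) ⊕ Q^ suc (suc k) ⊗ 𝟎
      ≈⟨ ≈-refl ⟨⊕⟩ vanish₁ ⟨⊕⟩ ≈-refl ⟩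
    Q^ 0 ⊗ qbinom n k ⊕ 𝟎 ⊕ Q^ suc (suc k) ⊗ 𝟎
      ≈⟨ solve 4 (λ a g b c → a :* g :+ con (+ 0) :+ b :* con (+ 0)
                    := (con (+ 1) :+ c) :* con (+ 0) :+ a :* g :+ b :* con (+ 0)) ≈-refl
           (Q^ 0) (qbinom n k) (Q^ suc (suc k)) (Q^ suc n) ⟩
    (𝟏 ⊕ Q^ suc n) ⊗ 𝟎 ⊕ Q^ 0 ⊗ qbinom n k ⊕ Q^ suc (suc k) ⊗ 𝟎
      ≈⟨ ≈-refl ⟨⊗⟩ ≈-sym vanish₁ ⟨⊕⟩ ≈-refl ⟨⊕⟩ ≈-refl ⟨⊗⟩ ≈-sym vanish₂ ⟩
    (𝟏 ⊕ Q^ suc n) ⊗ qbinom n (suc k) ⊕ Q^ 0 ⊗ qbinom n k ⊕ Q^ suc (suc k) ⊗ qbinom n (suc (suc k)) ∎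
    where
    open ≈-Reasoning
    n = k + 0
    n≤k : n ≤ k
    n≤k = ℕ.≤-reflexive (ℕ.+-identityʳ k)
    vanish₁ : qbinom n (suc k) ≈ 𝟎
    vanish₁ = qbinom-vanish (s≤s n≤k)
    vanish₂ : qbinom n (suc (suc k)) ≈ 𝟎
    vanish₂ = qbinom-vanish (ℕ.m<n⇒m<1+n (s≤s n≤k))
  qbinom-suc-suc k (suc r) = begin
    qbinom (suc n) (suc k) ⊕ Q^ suc (suc k) ⊗ qbinom (suc n) (suc (suc k))
      ≈⟨ qbinom-pascal′ k (suc r)
         ⟨⊕⟩ ≈-refl ⟨⊗⟩ ≈-trans (qbinom-congˡ (suc (suc k)) (cong suc (ℕ.+-suc k r)))
                                (qbinom-pascal′ (suc k) r) ⟩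
    Q^ suc r ⊗ qbinom n k ⊕ qbinom n (suc k)
      ⊕ Q^ suc (suc k) ⊗ (Q^ r ⊗ qbinom (suc k + r) (suc k) ⊕ qbinom (suc k + r) (suc (suc k)))
      ≈⟨ ≈-refl ⟨⊕⟩ ≈-refl ⟨⊗⟩ (≈-refl ⟨⊗⟩ qbinom-congˡ (suc k) (sym (ℕ.+-suc k r))
                                 ⟨⊕⟩ qbinom-congˡ (suc (suc k)) (sym (ℕ.+-suc k r))) ⟩
    Q^ suc r ⊗ qbinom n k ⊕ qbinom n (suc k) ⊕ Q^ suc (suc k) ⊗ (Q^ r ⊗ qbinom n (suc k) ⊕ qbinom n (suc (suc k)))
      ≈⟨ regroup (Q^ suc r) (qbinom n k) (qbinom n (suc k)) (Q^ suc (suc k)) (Q^ r) (qbinom n (suc (suc k))) ⟩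
    (𝟏 ⊕ Q^ suc (suc k) ⊗ Q^ r) ⊗ qbinom n (suc k) ⊕ Q^ suc r ⊗ qbinom n k ⊕ Q^ suc (suc k) ⊗ qbinom n (suc (suc k))
      ≈⟨ (≈-refl ⟨⊕⟩ ≈-trans (Q^-+ (suc (suc k)) r) (≈-reflexive (cong (λ i → Q^ suc i) (sym (ℕ.+-suc k r)))))
           ⟨⊗⟩ ≈-refl ⟨⊕⟩ ≈-refl ⟨⊕⟩ ≈-refl ⟩
    (𝟏 ⊕ Q^ suc n) ⊗ qbinom n (suc k) ⊕ Q^ suc r ⊗ qbinom n k ⊕ Q^ suc (suc k) ⊗ qbinom n (suc (suc k)) ∎
    where
    open ≈-Reasoning
    n = k + suc r
    regroup : ∀ a b c d f g → a ⊗ b ⊕ c ⊕ d ⊗ (f ⊗ c ⊕ g) ≈ (𝟏 ⊕ d ⊗ f) ⊗ c ⊕ a ⊗ b ⊕ d ⊗ g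
    regroup = solve 6 (λ a b c d f g → a :* b :+ c :+ d :* (f :* c :+ g)
                         := (con (+ 1) :+ d :* f) :* c :+ a :* b :+ d :* g) ≈-refl

module SymmetricSum (E : PS) (E²≈𝟏 : E ⊗ E ≈ 𝟏) where

  infix 8 E^_
  E^_ : ℕ → PS
  E^ zero  = 𝟏
  E^ suc j = E ⊗ E^ j

  -- Σ_{|j| ≤ K} E^j c_|j|, folded using E^-j = E^j.
  symSum : ℕ → (ℕ → PS) → PS
  symSum K c = c 0 ⊕ 𝟐 ⊗ ∑[ i < K ] (E^ suc i ⊗ c (suc i))

  symSum-cong-≈[] : ∀ K {M c c′} → (∀ j → j ≤ K → c j ≈[ M ] c′ j) → symSum K c ≈[ M ] symSum K c′
  symSum-cong-≈[] K c≈c′ = ≈[]-⊕ (c≈c′ 0 z≤n) (≈[]-⊗ ≈[]-refl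
    (∑-cong-≈[] K λ i i<K → ≈[]-⊗ (≈[]-refl {f = E^ suc i}) (c≈c′ (suc i) i<K)))

  symSum-distribˡ : ∀ K g c → g ⊗ symSum K c ≈ symSum K (λ j → g ⊗ c j)
  symSum-distribˡ K g c = begin
    g ⊗ (c 0 ⊕ 𝟐 ⊗ S)                    ≈⟨ solve 3 (λ g c₀ S → g :* (c₀ :+ con (+ 2) :* S)
                                                  := g :* c₀ :+ con (+ 2) :* (g :* S)) ≈-refl g (c 0) S ⟩
    g ⊗ c 0 ⊕ 𝟐 ⊗ (g ⊗ S)                ≈⟨ ≈-refl ⟨⊕⟩ ≈-refl ⟨⊗⟩ ≈-sym (∑-distribˡ K g _) ⟩
    g ⊗ c 0 ⊕ 𝟐 ⊗ ∑[ i < K ] (g ⊗ (E^ suc i ⊗ c (suc i)))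
                                          ≈⟨ ≈-refl ⟨⊕⟩ ≈-refl ⟨⊗⟩ ∑-cong K (λ i _ → swap g (E^ suc i) (c (suc i))) ⟩
    g ⊗ c 0 ⊕ 𝟐 ⊗ ∑[ i < K ] (E^ suc i ⊗ (g ⊗ c (suc i))) ∎
    where
    open ≈-Reasoning
    S = ∑[ i < K ] (E^ suc i ⊗ c (suc i))
    swap : ∀ a b c → a ⊗ (b ⊗ c) ≈ b ⊗ (a ⊗ c)
    swap = solve 3 (λ a b c → a :* (b :* c) := b :* (a :* c)) ≈-refl

  ∑-E^-head : ∀ K (f : ℕ → PS) → ∑[ i < suc K ] (E^ suc i ⊗ f i) ≈ E ⊗ f 0 ⊕ E ⊗ ∑[ i < K ] (E^ suc i ⊗ f (suc i))
  ∑-E^-head K f = ≈-trans (∑-head K (λ i → E^ suc i ⊗ f i))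
    (solve 2 (λ E f₀ → E :* con (+ 1) :* f₀ := E :* f₀) ≈-refl E (f 0)
     ⟨⊕⟩ ≈-trans (∑-cong K (λ i _ → ⊗-assoc E (E^ suc i) (f (suc i)))) (∑-distribˡ K E (λ i → E^ suc i ⊗ f (suc i))))

  𝟏⊕E-square : ∀ a → 𝟏 ⊕ 𝟐 ⊗ E ⊗ a ⊕ a ⊗ a ≈ (𝟏 ⊕ E ⊗ a) ⊗ (𝟏 ⊕ E ⊗ a)
  𝟏⊕E-square a = begin
    𝟏 ⊕ 𝟐 ⊗ E ⊗ a ⊕ a ⊗ a                ≈⟨ ≈-refl ⟨⊕⟩ ≈-sym (≈-trans (E²≈𝟏 ⟨⊗⟩ ≈-refl) (⊗-identityˡ (a ⊗ a))) ⟩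
    𝟏 ⊕ 𝟐 ⊗ E ⊗ a ⊕ E ⊗ E ⊗ (a ⊗ a)      ≈⟨ solve 2 (λ E a → con (+ 1) :+ con (+ 2) :* E :* a :+ E :* E :* (a :* a)
                                                  := (con (+ 1) :+ E :* a) :* (con (+ 1) :+ E :* a)) ≈-refl E a ⟩
    (𝟏 ⊕ E ⊗ a) ⊗ (𝟏 ⊕ E ⊗ a)            ∎
    where open ≈-Reasoning

  symSum-step : ∀ N a (c c′ : ℕ → PS)
    → c′ 0 ≈ (𝟏 ⊕ a ⊗ a) ⊗ c 0 ⊕ 𝟐 ⊗ a ⊗ c 1
    → (∀ i → i ≤ N → c′ (suc i) ≈ (𝟏 ⊕ a ⊗ a) ⊗ c (suc i) ⊕ a ⊗ c i ⊕ a ⊗ c (suc (suc i)))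
    → c (suc N) ≈ 𝟎 → c (suc (suc N)) ≈ 𝟎
    → symSum (suc N) c′ ≈ (𝟏 ⊕ E ⊗ a) ⊗ (𝟏 ⊕ E ⊗ a) ⊗ symSum N c
  symSum-step N a c c′ c′₀≈ c′ₛ≈ c₁₊N≈𝟎 c₂₊N≈𝟎 = begin
    c′ 0 ⊕ 𝟐 ⊗ ∑[ i < suc N ] (E^ suc i ⊗ c′ (suc i))
      ≈⟨ c′₀≈ ⟨⊕⟩ ≈-refl ⟨⊗⟩ expand ⟩
    (𝟏 ⊕ a ⊗ a) ⊗ c 0 ⊕ 𝟐 ⊗ a ⊗ c 1 ⊕ 𝟐 ⊗ ((𝟏 ⊕ a ⊗ a) ⊗ Aₛ ⊕ a ⊗ A₀ ⊕ a ⊗ Aₛₛ)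
      ≈⟨ ≈-refl ⟨⊕⟩ ≈-refl ⟨⊗⟩ (≈-refl ⟨⊗⟩ Aₛ≈ ⟨⊕⟩ ≈-refl ⟨⊗⟩ A₀≈ ⟨⊕⟩ ≈-refl ⟨⊗⟩ Aₛₛ≈) ⟩
    (𝟏 ⊕ a ⊗ a) ⊗ c 0 ⊕ 𝟐 ⊗ a ⊗ c 1 ⊕ 𝟐 ⊗ ((𝟏 ⊕ a ⊗ a) ⊗ S ⊕ a ⊗ (E ⊗ c 0 ⊕ E ⊗ S) ⊕ a ⊗ (E ⊗ S ⊕ ⊖ c 1))
      ≈⟨ collect (c 0) (c 1) S a E ⟩
    (𝟏 ⊕ 𝟐 ⊗ E ⊗ a ⊕ a ⊗ a) ⊗ (c 0 ⊕ 𝟐 ⊗ S)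
      ≈⟨ 𝟏⊕E-square a ⟨⊗⟩ ≈-refl ⟩
    (𝟏 ⊕ E ⊗ a) ⊗ (𝟏 ⊕ E ⊗ a) ⊗ (c 0 ⊕ 𝟐 ⊗ S) ∎
    where
    open ≈-Reasoning
    S   = ∑[ i < N ] (E^ suc i ⊗ c (suc i))
    Aₛ  = ∑[ i < suc N ] (E^ suc i ⊗ c (suc i))
    A₀  = ∑[ i < suc N ] (E^ suc i ⊗ c i)
    Aₛₛ = ∑[ i < suc N ] (E^ suc i ⊗ c (suc (suc i)))

    expand : ∑[ i < suc N ] (E^ suc i ⊗ c′ (suc i)) ≈ (𝟏 ⊕ a ⊗ a) ⊗ Aₛ ⊕ a ⊗ A₀ ⊕ a ⊗ Aₛₛ
    expand = begin
      ∑[ i < suc N ] (E^ suc i ⊗ c′ (suc i))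
        ≈⟨ ∑-cong (suc N) (λ i i<1+N → ≈-trans (≈-refl ⟨⊗⟩ c′ₛ≈ i (ℕ.≤-pred i<1+N))
             (spread (E^ suc i) (𝟏 ⊕ a ⊗ a) a (c (suc i)) (c i) (c (suc (suc i))))) ⟩
      ∑[ i < suc N ] ((𝟏 ⊕ a ⊗ a) ⊗ (E^ suc i ⊗ c (suc i)) ⊕ a ⊗ (E^ suc i ⊗ c i) ⊕ a ⊗ (E^ suc i ⊗ c (suc (suc i))))
        ≈⟨ ≈-trans (∑-⊕ (suc N) _ _) (∑-⊕ (suc N) _ _ ⟨⊕⟩ ≈-refl) ⟩
      ∑[ i < suc N ] ((𝟏 ⊕ a ⊗ a) ⊗ (E^ suc i ⊗ c (suc i))) ⊕ ∑[ i < suc N ] (a ⊗ (E^ suc i ⊗ c i))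
        ⊕ ∑[ i < suc N ] (a ⊗ (E^ suc i ⊗ c (suc (suc i))))
        ≈⟨ ∑-distribˡ (suc N) _ _ ⟨⊕⟩ ∑-distribˡ (suc N) _ _ ⟨⊕⟩ ∑-distribˡ (suc N) _ _ ⟩
      (𝟏 ⊕ a ⊗ a) ⊗ Aₛ ⊕ a ⊗ A₀ ⊕ a ⊗ Aₛₛ ∎
      where
      spread : ∀ e u a x y z → e ⊗ (u ⊗ x ⊕ a ⊗ y ⊕ a ⊗ z) ≈ u ⊗ (e ⊗ x) ⊕ a ⊗ (e ⊗ y) ⊕ a ⊗ (e ⊗ z)
      spread = solve 6 (λ e u a x y z → e :* (u :* x :+ a :* y :+ a :* z)
                          := u :* (e :* x) :+ a :* (e :* y) :+ a :* (e :* z)) ≈-refl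

    Aₛ≈ : Aₛ ≈ S
    Aₛ≈ = ∑-last-𝟎 N _ (≈-trans (≈-refl ⟨⊗⟩ c₁₊N≈𝟎) (⊗-zeroʳ (E^ suc N)))

    A₀≈ : A₀ ≈ E ⊗ c 0 ⊕ E ⊗ S
    A₀≈ = ∑-E^-head N c

    -- Since E = E⁻¹, multiplying by E shifts the weights: E ⊗ Aₛₛ is Aₛ without its first term E c₁.
    Aₛₛ≈ : Aₛₛ ≈ E ⊗ S ⊕ ⊖ c 1
    Aₛₛ≈ = begin
      Aₛₛ                                   ≈⟨ ≈-sym (≈-trans (E²≈𝟏 ⟨⊗⟩ ≈-refl) (⊗-identityˡ Aₛₛ)) ⟩
      E ⊗ E ⊗ Aₛₛ                           ≈⟨ solve 3 (λ E c A → E :* E :* A := E :* (E :* c :+ E :* A) :+ :- (E :* E :* c))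
                                                 ≈-refl E (c 1) Aₛₛ ⟩
      E ⊗ (E ⊗ c 1 ⊕ E ⊗ Aₛₛ) ⊕ ⊖ (E ⊗ E ⊗ c 1)
                                            ≈⟨ ≈-refl ⟨⊗⟩ ≈-trans (≈-sym (∑-E^-head (suc N) (c ∘ suc))) shifted
                                               ⟨⊕⟩ ⟨⊖⟩ (≈-trans (E²≈𝟏 ⟨⊗⟩ ≈-refl) (⊗-identityˡ (c 1))) ⟩
      E ⊗ S ⊕ ⊖ c 1                         ∎
      where
      shifted : ∑[ i < suc (suc N) ] (E^ suc i ⊗ c (suc i)) ≈ S
      shifted = ≈-trans (∑-last-𝟎 (suc N) _ (≈-trans (≈-refl ⟨⊗⟩ c₂₊N≈𝟎) (⊗-zeroʳ (E^ suc (suc N))))) Aₛ≈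

    collect : ∀ c₀ c₁ s a E →
      (𝟏 ⊕ a ⊗ a) ⊗ c₀ ⊕ 𝟐 ⊗ a ⊗ c₁ ⊕ 𝟐 ⊗ ((𝟏 ⊕ a ⊗ a) ⊗ s ⊕ a ⊗ (E ⊗ c₀ ⊕ E ⊗ s) ⊕ a ⊗ (E ⊗ s ⊕ ⊖ c₁))
        ≈ (𝟏 ⊕ 𝟐 ⊗ E ⊗ a ⊕ a ⊗ a) ⊗ (c₀ ⊕ 𝟐 ⊗ s)
    collect = solve 5 (λ c₀ c₁ s a E →
      (con (+ 1) :+ a :* a) :* c₀ :+ con (+ 2) :* a :* c₁
        :+ con (+ 2) :* ((con (+ 1) :+ a :* a) :* s :+ a :* (E :* c₀ :+ E :* s) :+ a :* (E :* s :+ :- c₁))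
      := (con (+ 1) :+ con (+ 2) :* E :* a :+ a :* a) :* (c₀ :+ con (+ 2) :* s)) ≈-refl

module JacobiTriple (d : ℕ) {{_ : NonZero d}} (E : PS) (E²≈𝟏 : E ⊗ E ≈ 𝟏) where
  open QBinomial (2 * d) {{ℕ.m*n≢0 2 d}} public
  open SymmetricSum E E²≈𝟏 public

  infix 8 x^_
  x^_ : ℕ → PS
  x^ a = q^ (d * a)

  x^odd : ℕ → PS
  x^odd N = x^ suc (N + N)

  x^0 : x^ 0 ≈ 𝟏
  x^0 = ≈-trans (≈-reflexive (cong q^_ (ℕ.*-zeroʳ d))) q^0

  Q^≈x^x^ : ∀ i → Q^ i ≈ x^ i ⊗ x^ i
  Q^≈x^x^ i = ≈-trans (≈-reflexive (cong q^_ (double d i))) (≈-sym (q^-+ (d * i) (d * i)))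
    where
    double : ∀ d i → 2 * d * i ≡ d * i + d * i
    double = ℕ-Solver.solve-∀

  jacobiCoeff : ℕ → ℕ → PS
  jacobiCoeff N j = x^ (j * j) ⊗ qbinom (N + N) (N + j)

  jacobiProd : ℕ → PS
  jacobiProd N = ∏[ k < N ] ((𝟏 ⊕ E ⊗ x^odd k) ⊗ (𝟏 ⊕ E ⊗ x^odd k))

  jacobiCoeff-vanish : ∀ {N j} → N < j → jacobiCoeff N j ≈ 𝟎
  jacobiCoeff-vanish {N} {j} N<j =
    ≈-trans (≈-refl ⟨⊗⟩ qbinom-vanish (ℕ.+-monoʳ-< N N<j)) (⊗-zeroʳ (x^ (j * j)))

  jacobiCoeff-step₀ : ∀ N → jacobiCoeff (suc N) 0 ≈
    (𝟏 ⊕ x^odd N ⊗ x^odd N) ⊗ jacobiCoeff N 0 ⊕ 𝟐 ⊗ x^odd N ⊗ jacobiCoeff N 1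
  jacobiCoeff-step₀ zero = begin
    x^ 0 ⊗ (𝟏 ⊕ Q^ 1 ⊗ (𝟏 ⊕ Q^ 1 ⊗ 𝟎))
      ≈⟨ x^0 ⟨⊗⟩ (≈-refl ⟨⊕⟩ Q^≈x^x^ 1 ⟨⊗⟩ (≈-refl ⟨⊕⟩ Q^≈x^x^ 1 ⟨⊗⟩ ≈-refl)) ⟩
    𝟏 ⊗ (𝟏 ⊕ a ⊗ a ⊗ (𝟏 ⊕ a ⊗ a ⊗ 𝟎))
      ≈⟨ solve 1 (λ a → con (+ 1) :* (con (+ 1) :+ a :* a :* (con (+ 1) :+ a :* a :* con (+ 0)))
                    := (con (+ 1) :+ a :* a) :* (con (+ 1) :* con (+ 1)) :+ con (+ 2) :* a :* (a :* con (+ 0)))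
           ≈-refl a ⟩
    (𝟏 ⊕ a ⊗ a) ⊗ (𝟏 ⊗ 𝟏) ⊕ 𝟐 ⊗ a ⊗ (a ⊗ 𝟎)
      ≈⟨ ≈-refl ⟨⊗⟩ (≈-sym x^0 ⟨⊗⟩ ≈-refl) ⟨⊕⟩ ≈-refl ⟩
    (𝟏 ⊕ a ⊗ a) ⊗ (x^ 0 ⊗ 𝟏) ⊕ 𝟐 ⊗ a ⊗ (a ⊗ 𝟎) ∎
    where
    open ≈-Reasoning
    a = x^ 1
  jacobiCoeff-step₀ (suc M) = begin
    x^ 0 ⊗ qbinom (suc (suc M) + suc (suc M)) (suc (suc M) + 0)
      ≈⟨ x^0 ⟨⊗⟩ ≈-trans (qbinom-cong (idx₁ M) (ℕ.+-identityʳ (suc (suc M)))) (qbinom-suc-suc M (suc (suc M))) ⟩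
    𝟏 ⊗ ((𝟏 ⊕ Q^ suc n) ⊗ qbinom n (suc M) ⊕ Q^ suc (suc M) ⊗ qbinom n M ⊕ Q^ suc (suc M) ⊗ qbinom n (suc (suc M)))
      ≈⟨ ≈-refl ⟨⊗⟩ ((≈-refl ⟨⊕⟩ ≈-trans (≈-reflexive (cong (λ k → Q^ suc k) (idx₂ M))) (Q^≈x^x^ _))
                        ⟨⊗⟩ qbinom-cong (idx₂ M) (sym (ℕ.+-identityʳ (suc M)))
                     ⟨⊕⟩ ≈-sym a⊗x≈Q^ ⟨⊗⟩ ≈-trans (qbinom-sym M (suc (suc M))) (qbinom-cong (idx₂ M) (idx₃ M))
                     ⟨⊕⟩ ≈-sym a⊗x≈Q^ ⟨⊗⟩ qbinom-cong (idx₂ M) (idx₃ M)) ⟩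
    𝟏 ⊗ ((𝟏 ⊕ a ⊗ a) ⊗ G₀ ⊕ a ⊗ x^ 1 ⊗ G₁ ⊕ a ⊗ x^ 1 ⊗ G₁)
      ≈⟨ solve 4 (λ a g₀ y g₁ → con (+ 1) :* ((con (+ 1) :+ a :* a) :* g₀ :+ a :* y :* g₁ :+ a :* y :* g₁)
                    := (con (+ 1) :+ a :* a) :* (con (+ 1) :* g₀) :+ con (+ 2) :* a :* (y :* g₁)) ≈-refl a G₀ (x^ 1) G₁ ⟩
    (𝟏 ⊕ a ⊗ a) ⊗ (𝟏 ⊗ G₀) ⊕ 𝟐 ⊗ a ⊗ (x^ 1 ⊗ G₁)
      ≈⟨ ≈-refl ⟨⊗⟩ (≈-sym x^0 ⟨⊗⟩ ≈-refl) ⟨⊕⟩ ≈-refl ⟩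
    (𝟏 ⊕ a ⊗ a) ⊗ (x^ 0 ⊗ G₀) ⊕ 𝟐 ⊗ a ⊗ (x^ 1 ⊗ G₁) ∎
    where
    open ≈-Reasoning
    n  = M + suc (suc M)
    a  = x^odd (suc M)
    G₀ = qbinom (suc M + suc M) (suc M + 0)
    G₁ = qbinom (suc M + suc M) (suc M + 1)
    idx₁ : ∀ M → suc (suc M) + suc (suc M) ≡ suc (suc (M + suc (suc M)))
    idx₁ = ℕ-Solver.solve-∀
    idx₂ : ∀ M → M + suc (suc M) ≡ suc M + suc M
    idx₂ = ℕ-Solver.solve-∀
    idx₃ : ∀ M → suc (suc M) ≡ suc M + 1
    idx₃ = ℕ-Solver.solve-∀
    exponent : ∀ d M → d * suc (suc M + suc M) + d * 1 ≡ 2 * d * suc (suc M)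
    exponent = ℕ-Solver.solve-∀
    a⊗x≈Q^ : a ⊗ x^ 1 ≈ Q^ suc (suc M)
    a⊗x≈Q^ = ≈-trans (q^-+ (d * suc (suc M + suc M)) (d * 1)) (≈-reflexive (cong q^_ (exponent d M)))

  jacobiCoeff-step : ∀ {N i} → i ≤ N → jacobiCoeff (suc N) (suc i) ≈
    (𝟏 ⊕ x^odd N ⊗ x^odd N) ⊗ jacobiCoeff N (suc i) ⊕ x^odd N ⊗ jacobiCoeff N i ⊕ x^odd N ⊗ jacobiCoeff N (suc (suc i))
  jacobiCoeff-step {N} {i} i≤N with ℕ.m≤n⇒∃[o]m+o≡n i≤N
  ... | m , refl = begin
    x^ (suc i * suc i) ⊗ qbinom (suc N + suc N) (suc N + suc i)
      ≈⟨ ≈-refl ⟨⊗⟩ ≈-trans (qbinom-cong (idx₁ i m) (idx₂ i m)) (qbinom-suc-suc (N + i) m) ⟩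
    x^ (suc i * suc i) ⊗ ((𝟏 ⊕ Q^ suc ((N + i) + m)) ⊗ qbinom ((N + i) + m) (suc (N + i))
      ⊕ Q^ m ⊗ qbinom ((N + i) + m) (N + i) ⊕ Q^ suc (suc (N + i)) ⊗ qbinom ((N + i) + m) (suc (suc (N + i))))
      ≈⟨ ≈-refl ⟨⊗⟩ ((≈-refl ⟨⊕⟩ ≈-reflexive (cong (λ k → Q^ suc k) (sym (idx₃ i m))))
                        ⟨⊗⟩ qbinom-cong (sym (idx₃ i m)) (sym (ℕ.+-suc N i))
                     ⟨⊕⟩ ≈-refl ⟨⊗⟩ qbinom-congˡ (N + i) (sym (idx₃ i m))
                     ⟨⊕⟩ ≈-refl ⟨⊗⟩ qbinom-cong (sym (idx₃ i m)) (sym (idx₄ i m))) ⟩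
    x^ (suc i * suc i) ⊗ ((𝟏 ⊕ Q^ suc (N + N)) ⊗ qbinom (N + N) (N + suc i)
      ⊕ Q^ m ⊗ qbinom (N + N) (N + i) ⊕ Q^ suc (suc (N + i)) ⊗ qbinom (N + N) (N + suc (suc i)))
      ≈⟨ spread (x^ (suc i * suc i)) _ _ _ _ _ _ ⟩
    (𝟏 ⊕ Q^ suc (N + N)) ⊗ jacobiCoeff N (suc i)
      ⊕ (x^ (suc i * suc i) ⊗ Q^ m) ⊗ qbinom (N + N) (N + i)
      ⊕ (x^ (suc i * suc i) ⊗ Q^ suc (suc (N + i))) ⊗ qbinom (N + N) (N + suc (suc i))
      ≈⟨ (≈-refl ⟨⊕⟩ Q^≈x^x^ (suc (N + N))) ⟨⊗⟩ ≈-refl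
         ⟨⊕⟩ lower-neighbour ⟨⊗⟩ ≈-refl ⟨⊕⟩ upper-neighbour ⟨⊗⟩ ≈-refl ⟩
    (𝟏 ⊕ a ⊗ a) ⊗ jacobiCoeff N (suc i) ⊕ (a ⊗ x^ (i * i)) ⊗ qbinom (N + N) (N + i)
      ⊕ (a ⊗ x^ (suc (suc i) * suc (suc i))) ⊗ qbinom (N + N) (N + suc (suc i))
      ≈⟨ ≈-refl ⟨⊕⟩ ⊗-assoc _ _ _ ⟨⊕⟩ ⊗-assoc _ _ _ ⟩
    (𝟏 ⊕ a ⊗ a) ⊗ jacobiCoeff N (suc i) ⊕ a ⊗ jacobiCoeff N i ⊕ a ⊗ jacobiCoeff N (suc (suc i)) ∎
    where
    open ≈-Reasoning
    a = x^odd N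
    spread : ∀ y u g₁ b g₀ c g₂ → y ⊗ ((𝟏 ⊕ u) ⊗ g₁ ⊕ b ⊗ g₀ ⊕ c ⊗ g₂)
                                  ≈ (𝟏 ⊕ u) ⊗ (y ⊗ g₁) ⊕ (y ⊗ b) ⊗ g₀ ⊕ (y ⊗ c) ⊗ g₂
    spread = solve 7 (λ y u g₁ b g₀ c g₂ → y :* ((con (+ 1) :+ u) :* g₁ :+ b :* g₀ :+ c :* g₂)
                        := (con (+ 1) :+ u) :* (y :* g₁) :+ (y :* b) :* g₀ :+ (y :* c) :* g₂) ≈-refl
    idx₁ : ∀ i m → suc (i + m) + suc (i + m) ≡ suc (suc (((i + m) + i) + m))
    idx₁ = ℕ-Solver.solve-∀
    idx₂ : ∀ i m → suc (i + m) + suc i ≡ suc (suc ((i + m) + i))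
    idx₂ = ℕ-Solver.solve-∀
    idx₃ : ∀ i m → (i + m) + (i + m) ≡ ((i + m) + i) + m
    idx₃ = ℕ-Solver.solve-∀
    idx₄ : ∀ i m → (i + m) + suc (suc i) ≡ suc (suc ((i + m) + i))
    idx₄ = ℕ-Solver.solve-∀
    exponent₁ : ∀ d i m → d * (suc i * suc i) + 2 * d * m ≡ d * suc ((i + m) + (i + m)) + d * (i * i)
    exponent₁ = ℕ-Solver.solve-∀
    exponent₂ : ∀ d i m → d * (suc i * suc i) + 2 * d * suc (suc ((i + m) + i))
                          ≡ d * suc ((i + m) + (i + m)) + d * (suc (suc i) * suc (suc i))
    exponent₂ = ℕ-Solver.solve-∀
    lower-neighbour : x^ (suc i * suc i) ⊗ Q^ m ≈ a ⊗ x^ (i * i)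
    lower-neighbour = q^-⊗-cong (exponent₁ d i m)
    upper-neighbour : x^ (suc i * suc i) ⊗ Q^ suc (suc (N + i)) ≈ a ⊗ x^ (suc (suc i) * suc (suc i))
    upper-neighbour = q^-⊗-cong (exponent₂ d i m)

  jacobi-triple-product : ∀ N → symSum N (jacobiCoeff N) ≈ jacobiProd N
  jacobi-triple-product zero = ≈-trans
    (solve 1 (λ x → x :* con (+ 1) :+ con (+ 2) :* con (+ 0) := x) ≈-refl (x^ 0)) x^0
  jacobi-triple-product (suc N) = ≈-trans
    (symSum-step N (x^odd N) (jacobiCoeff N) (jacobiCoeff (suc N))
       (jacobiCoeff-step₀ N) (λ i i≤N → jacobiCoeff-step i≤N)
       (jacobiCoeff-vanish (ℕ.n<1+n N)) (jacobiCoeff-vanish (ℕ.m<n⇒m<1+n (ℕ.n<1+n N))))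
    (≈-trans (≈-refl ⟨⊗⟩ jacobi-triple-product N) (⊗-comm _ (jacobiProd N)))

  qPoch-jacobiCoeff-≈[] : ∀ {N j} → j ≤ N → qPoch N ⊗ jacobiCoeff N j ≈[ d * suc (N + N) ] x^ (j * j)
  qPoch-jacobiCoeff-≈[] {N} {j} j≤N with ℕ.m≤n⇒∃[o]m+o≡n j≤N
  ... | m , refl = ≈[]-weaken precision (begin
    qPoch N ⊗ (x^ (j * j) ⊗ qbinom (N + N) (N + j))
      ≈⟨ ≈⇒≈[] (solve 3 (λ p y g → p :* (y :* g) := y :* (p :* g)) ≈-refl (qPoch N) (x^ (j * j)) _) ⟩
    x^ (j * j) ⊗ (qPoch N ⊗ qbinom (N + N) (N + j))
      ≈⟨ q^-⊗-≈[] (d * (j * j)) central ⟩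
    x^ (j * j) ⊗ 𝟏
      ≈⟨ ≈⇒≈[] (⊗-identityʳ (x^ (j * j))) ⟩
    x^ (j * j) ∎)
    where
    open ≈[]-Reasoning (d * (j * j) + 2 * d * suc m)
    idx : ∀ j m → (j + m) + (j + m) ≡ ((j + m) + j) + m
    idx = ℕ-Solver.solve-∀
    central : qPoch N ⊗ qbinom (N + N) (N + j) ≈[ 2 * d * suc m ] 𝟏
    central = ≈[]-trans
      (≈[]-⊗ (≈[]-trans (qPoch-stable (ℕ.m≤n+m m j))
                        (≈[]-sym (qPoch-stable {n = N + j} (ℕ.≤-trans (ℕ.m≤n+m m j) (ℕ.m≤m+n N j)))))
             (≈⇒≈[] (qbinom-congˡ (N + j) (idx j m))))
      (≈[]-trans (≈⇒≈[] (⊗-comm (qPoch (N + j)) _)) (qbinom-qPoch-≈[] (N + j) m))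
    -- 2N + 1 ≤ j² + 2(N - j) + 2 is (j - 1)² ≥ 0.
    odd≤ : ∀ j m → suc ((j + m) + (j + m)) ≤ j * j + 2 * suc m
    odd≤ zero    m = ℕ.≤-trans (ℕ.n≤1+n _) (ℕ.≤-reflexive (eq₀ m))
      where
      eq₀ : ∀ m → suc (suc (m + m)) ≡ 0 * 0 + 2 * suc m
      eq₀ = ℕ-Solver.solve-∀
    odd≤ (suc t) m = subst (suc ((suc t + m) + (suc t + m)) ≤_) (eqₛ t m) (ℕ.m≤n+m _ (t * t))
      where
      eqₛ : ∀ t m → t * t + suc ((suc t + m) + (suc t + m)) ≡ suc t * suc t + 2 * suc m
      eqₛ = ℕ-Solver.solve-∀
    distrib : ∀ d j m → d * (j * j + 2 * suc m) ≡ d * (j * j) + 2 * d * suc m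
    distrib = ℕ-Solver.solve-∀
    precision : d * suc (N + N) ≤ d * (j * j) + 2 * d * suc m
    precision = ℕ.≤-trans (ℕ.*-monoʳ-≤ d (odd≤ j m)) (ℕ.≤-reflexive (distrib d j m))

  θ₊ : ℕ → PS
  θ₊ N = ∑[ i < N ] (E^ suc i ⊗ x^ (suc i * suc i))

  qPoch-jacobiProd-≈[] : ∀ N → qPoch N ⊗ jacobiProd N ≈[ d * suc (N + N) ] 𝟏 ⊕ 𝟐 ⊗ θ₊ N
  qPoch-jacobiProd-≈[] N = begin
    qPoch N ⊗ jacobiProd N                        ≈⟨ ≈⇒≈[] (≈-refl ⟨⊗⟩ ≈-sym (jacobi-triple-product N)) ⟩
    qPoch N ⊗ symSum N (jacobiCoeff N)            ≈⟨ ≈⇒≈[] (symSum-distribˡ N (qPoch N) (jacobiCoeff N)) ⟩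
    symSum N (λ j → qPoch N ⊗ jacobiCoeff N j)    ≈⟨ symSum-cong-≈[] N (λ j j≤N → qPoch-jacobiCoeff-≈[] j≤N) ⟩
    x^ 0 ⊕ 𝟐 ⊗ θ₊ N                               ≈⟨ ≈⇒≈[] (x^0 ⟨⊕⟩ ≈-refl) ⟩
    𝟏 ⊕ 𝟐 ⊗ θ₊ N                                  ∎
    where open ≈[]-Reasoning (d * suc (N + N))

𝟏-coeff-pos : ∀ {n} → 0 < n → 𝟏 n ≡ + 0
𝟏-coeff-pos {suc n} _ = cst-coeff-suc (+ 1) n

binom-≈ : ∀ c m .{{_ : NonZero m}} → binom c m ≈ 𝟏 ⊕ cst c ⊗ q^ m
binom-≈ c m = mk≈ λ n → sym (trans (⊕-coeff 𝟏 (cst c ⊗ q^ m) n)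
  (trans (cong (ℤ._+_ (𝟏 n)) (cst-⊗-coeff c (q^ m) n)) (coeff-eq n)))
  where
  select : ∀ {b b′} → b ≡ b′ → (if b then c else + 0) ≡ (if b′ then c else + 0)
  select = cong (λ b → if b then c else + 0)
  coeff-eq : ∀ n → 𝟏 n ℤ.+ c ℤ.* (q^ m) n ≡ binom c m n
  coeff-eq zero = begin
    𝟏 0 ℤ.+ c ℤ.* (q^ m) 0   ≡⟨ cong₂ (λ a b → a ℤ.+ c ℤ.* b) (cst-coeff-zero (+ 1)) (q^-coeff-< (N.>-nonZero⁻¹ m)) ⟩
    + 1 ℤ.+ c ℤ.* + 0        ≡⟨ cong (ℤ._+_ (+ 1)) (ℤ.*-zeroʳ c) ⟩
    + 1                      ∎
    where open ≡-Reasoning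
  coeff-eq (suc n) with suc n N.≟ m
  ... | yes refl = trans (cong₂ (λ a b → a ℤ.+ c ℤ.* b) (cst-coeff-suc (+ 1) n) (q^-coeff-≡ (suc n)))
    (trans (trans (ℤ.+-identityˡ _) (ℤ.*-identityʳ c)) (sym (select (dec-true (suc n N.≟ suc n) refl))))
  ... | no n≢m   = trans (cong₂ (λ a b → a ℤ.+ c ℤ.* b) (cst-coeff-suc (+ 1) n) (q^-coeff-≢ n≢m))
    (trans (cong (ℤ._+_ (+ 0)) (ℤ.*-zeroʳ c)) (sym (select (dec-false (suc n N.≟ m) n≢m))))

geom-∣ : ∀ {m n} → m ∣ℕ n → geom m n ≡ + 1
geom-∣ {m} {n} m∣n = cong (λ b → if b then + 1 else + 0) (dec-true (m ∣? n) m∣n)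

geom-∤ : ∀ {m n} → ¬ m ∣ℕ n → geom m n ≡ + 0
geom-∤ {m} {n} m∤n = cong (λ b → if b then + 1 else + 0) (dec-false (m ∣? n) m∤n)

geom-≈[] : ∀ m .{{_ : NonZero m}} → geom m ≈[ m ] 𝟏
geom-≈[] m = mk≈[] below
  where
  below : ∀ {n} → n < m → geom m n ≡ 𝟏 n
  below {zero}  _   = trans (geom-∣ (m ∣0)) (sym (cst-coeff-zero (+ 1)))
  below {suc n} n<m = trans (geom-∤ (λ m∣n → ℕ.<⇒≱ n<m (∣⇒≤ m∣n))) (sym (cst-coeff-suc (+ 1) n))

geom-periodic : ∀ m t → geom m (m + t) ≡ geom m t
geom-periodic m t = by-cases (m ∣? t)
  where
  by-cases : Dec (m ∣ℕ t) → geom m (m + t) ≡ geom m t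
  by-cases (yes m∣t) = trans (geom-∣ (∣m∣n⇒∣m+n ∣-refl m∣t)) (sym (geom-∣ m∣t))
  by-cases (no  m∤t) = trans (geom-∤ (λ m∣m+t → m∤t (∣m+n∣m⇒∣n m∣m+t ∣-refl))) (sym (geom-∤ m∤t))

geom-minus-shift : ∀ m .{{_ : NonZero m}} n → geom m n ℤ.+ ℤ.- shift m (geom m) n ≡ 𝟏 n
geom-minus-shift m n with n ℕ.<? m
... | yes n<m = trans (cong (λ x → geom m n ℤ.+ ℤ.- x) (shift-< (geom m) n<m))
                      (trans (ℤ.+-identityʳ _) (coeff< (geom-≈[] m) n<m))
... | no n≮m with ℕ.m≤n⇒∃[o]m+o≡n (ℕ.≮⇒≥ n≮m)
...   | t , refl = begin
  geom m (m + t) ℤ.+ ℤ.- shift m (geom m) (m + t)   ≡⟨ cong₂ (λ a b → a ℤ.+ ℤ.- b) (geom-periodic m t) (shift-+ m (geom m) t) ⟩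
  geom m t ℤ.+ ℤ.- geom m t                          ≡⟨ ℤ.+-inverseʳ (geom m t) ⟩
  + 0                                                ≡⟨ sym (𝟏-coeff-pos (ℕ.<-≤-trans (N.>-nonZero⁻¹ m) (ℕ.m≤m+n m t))) ⟩
  𝟏 (m + t)                                          ∎
  where open ≡-Reasoning

geom-inverse : ∀ m .{{_ : NonZero m}} → geom m ⊗ (𝟏 ⊕ ⊖ q^ m) ≈ 𝟏
geom-inverse m = begin
  geom m ⊗ (𝟏 ⊕ ⊖ q^ m)          ≈⟨ solve 2 (λ g y → g :* (con (+ 1) :+ :- y) := g :+ :- (y :* g)) ≈-refl (geom m) (q^ m) ⟩
  geom m ⊕ ⊖ (q^ m ⊗ geom m)     ≈⟨ ≈-refl ⟨⊕⟩ ⟨⊖⟩ (q^-⊗ m (geom m)) ⟩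
  geom m ⊕ ⊖ shift m (geom m)    ≈⟨ mk≈ (λ n → trans (⊕-coeff _ _ n)
                                      (trans (cong (ℤ._+_ (geom m n)) (⊖-coeff _ n)) (geom-minus-shift m n))) ⟩
  𝟏                              ∎
  where open ≈-Reasoning

-- The generating function

module Q₂ = QBinomial 2
⊖𝟏²≈𝟏 : ⊖ 𝟏 ⊗ ⊖ 𝟏 ≈ 𝟏
⊖𝟏²≈𝟏 = solve 0 (:- con (+ 1) :* :- con (+ 1) := con (+ 1)) ≈-refl

module J₂ = JacobiTriple 2 (⊖ 𝟏) ⊖𝟏²≈𝟏
module J₃ = JacobiTriple 3 𝟏 (⊗-identityˡ 𝟏)

R : ℕ → PS
R K = ∏[ k < K ] ((𝟏 ⊕ q^ (2 * suc k)) ⊗ geom (2 * suc k))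

factor-≈ : ∀ k → factor (suc k) ≈
  (𝟏 ⊕ q^ (2 * suc k)) ⊗ geom (2 * suc k) ⊗ ((𝟏 ⊕ ⊖ J₃.Q^ suc k) ⊗ ((𝟏 ⊕ 𝟏 ⊗ J₃.x^odd k) ⊗ (𝟏 ⊕ 𝟏 ⊗ J₃.x^odd k)))
factor-≈ k = ≈-trans
  (⊛-cong-⊗ (⊛-cong-⊗ (⊛-cong-⊗ (⊛-cong-⊗ (≈-trans (binom-≈ (+ 1) (2 * suc k)) (≈-refl ⟨⊕⟩ ⊗-identityˡ _)) ≈-refl)
                          (≈-trans (binom-≈ (ℤ.- + 1) (6 * suc k)) (≈-refl ⟨⊕⟩ negate _)))
              odd-factor) odd-factor)
  (solve 5 (λ a g b c d → a :* g :* b :* c :* d := a :* g :* (b :* (c :* d))) ≈-refl _ _ _ _ _)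
  where
  negate : ∀ f → cst (ℤ.- + 1) ⊗ f ≈ ⊖ f
  negate = solve 1 (λ f → con (ℤ.- + 1) :* f := :- f) ≈-refl
  odd : ∀ k → 6 * suc k ∸ 3 ≡ 3 * suc (k + k)
  odd k = trans (cong (_∸ 3) (six k)) (ℕ.m+n∸m≡n 3 _)
    where
    six : ∀ k → 6 * suc k ≡ 3 + 3 * suc (k + k)
    six = ℕ-Solver.solve-∀
  odd-factor : binom (+ 1) (6 * suc k ∸ 3) ≈ 𝟏 ⊕ 𝟏 ⊗ J₃.x^odd k
  odd-factor = ≈-trans (≈-reflexive (cong (binom (+ 1)) (odd k))) (binom-≈ (+ 1) (3 * suc (k + k)))

partialProd-≈-∏ : ∀ N → partialProd N ≈ ∏[ k < N ] factor (suc k)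
partialProd-≈-∏ zero    = ≈-sym cst-1
partialProd-≈-∏ (suc N) = ⊛-cong-⊗ (partialProd-≈-∏ N) ≈-refl

partialProd-≈ : ∀ N → partialProd N ≈ R N ⊗ (J₃.qPoch N ⊗ J₃.jacobiProd N)
partialProd-≈ N = ≈-trans (partialProd-≈-∏ N)
  (≈-trans (∏-cong N factor-≈) (≈-trans (∏-⊗ N _ _) (≈-refl ⟨⊗⟩ ∏-⊗ N _ _)))

factor-≈[]-𝟏 : ∀ k → factor (suc k) ≈[ suc k ] 𝟏
factor-≈[]-𝟏 k = ≈[]-trans (≈⇒≈[] (factor-≈ k))
  (⊗-≈[]-𝟏 (⊗-≈[]-𝟏 (𝟏⊕-≈[]-𝟏 (q^-≈[]-𝟎 k≤2k)) (≈[]-weaken k≤2k (geom-≈[] (2 * suc k))))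
           (⊗-≈[]-𝟏 (𝟏⊕-≈[]-𝟏 (⊖-≈[]-𝟎 (q^-≈[]-𝟎 (ℕ.m≤m+n (suc k) _))))
                    (⊗-≈[]-𝟏 odd-factor odd-factor)))
  where
  k≤2k : suc k ≤ 2 * suc k
  k≤2k = ℕ.m≤m+n (suc k) _
  odd-factor : 𝟏 ⊕ 𝟏 ⊗ J₃.x^odd k ≈[ suc k ] 𝟏
  odd-factor = 𝟏⊕-≈[]-𝟏 (⊗-≈[]-𝟎 𝟏 (q^-≈[]-𝟎 (ℕ.≤-trans (s≤s (ℕ.m≤m+n k k)) (ℕ.m≤m+n _ _))))

s≡partialProd : ∀ {n N} → n < N → s n ≡ partialProd N n
s≡partialProd {n} {N} n<N = coeff< (begin
  partialProd (suc n)             ≈⟨ ≈⇒≈[] (partialProd-≈-∏ (suc n)) ⟩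
  ∏[ k < suc n ] factor (suc k)   ≈⟨ ≈[]-sym (∏-stable _ (λ k n<k → ≈[]-weaken (ℕ.m≤n⇒m≤1+n n<k) (factor-≈[]-𝟏 k)) n<N) ⟩
  ∏[ k < N ] factor (suc k)       ≈⟨ ≈⇒≈[] (≈-sym (partialProd-≈-∏ N)) ⟩
  partialProd N                   ∎) (ℕ.n<1+n n)
  where open ≈[]-Reasoning (suc n)

V : ℕ → PS
V K = ∏[ k < K ] (𝟏 ⊕ q^ (2 * suc k))

-- (q²;q⁴)_L
W : ℕ → PS
W L = ∏[ k < L ] (𝟏 ⊕ ⊖ J₂.x^odd k)

R⊗qPoch₂≈V : ∀ K → R K ⊗ Q₂.qPoch K ≈ V K
R⊗qPoch₂≈V K = ≈-trans (≈-sym (∏-⊗ K _ _)) (∏-cong K λ k →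
  ≈-trans (⊗-assoc _ _ _) (≈-trans (≈-refl ⟨⊗⟩ geom-inverse (2 * suc k)) (⊗-identityʳ _)))

V⊗qPoch₂≈qPoch₄ : ∀ K → V K ⊗ Q₂.qPoch K ≈ J₂.qPoch K
V⊗qPoch₂≈qPoch₄ K = ≈-trans (≈-sym (∏-⊗ K _ _)) (∏-cong K λ k →
  ≈-trans (solve 1 (λ a → (con (+ 1) :+ a) :* (con (+ 1) :+ :- a) := con (+ 1) :+ :- (a :* a)) ≈-refl (q^ (2 * suc k)))
          (≈-refl ⟨⊕⟩ ⟨⊖⟩ (≈-trans (q^-+ _ _) (≈-reflexive (cong q^_ (double k))))))
  where
  double : ∀ k → 2 * suc k + 2 * suc k ≡ 2 * 2 * suc k
  double = ℕ-Solver.solve-∀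

jacobiProd₂≈W² : ∀ L → J₂.jacobiProd L ≈ W L ⊗ W L
jacobiProd₂≈W² L = ≈-trans (∏-cong L λ k → minus (J₂.x^odd k) ⟨⊗⟩ minus (J₂.x^odd k)) (∏-⊗ L _ _)
  where
  minus : ∀ x → 𝟏 ⊕ ⊖ 𝟏 ⊗ x ≈ 𝟏 ⊕ ⊖ x
  minus = solve 1 (λ x → con (+ 1) :+ :- con (+ 1) :* x := con (+ 1) :+ :- x) ≈-refl

qPoch₂-even-odd : ∀ L → Q₂.qPoch (L + L) ≈ W L ⊗ J₂.qPoch L
qPoch₂-even-odd L = ≈-trans (∏-even-odd L _) (≈-trans
  (∏-cong L λ k → ≈-refl ⟨⊗⟩ (≈-refl ⟨⊕⟩ ⟨⊖⟩ (≈-reflexive (cong q^_ (even k))))) (∏-⊗ L _ _))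
  where
  even : ∀ k → 2 * suc (suc (k + k)) ≡ 2 * 2 * suc k
  even = ℕ-Solver.solve-∀

-- Euler: (-q²;q²)_∞ (q²;q⁴)_∞ = 1, cancelling (q⁴;q⁴)_L from (-q²;q²)(q²;q²) = (q⁴;q⁴).
euler-≈[] : ∀ L → V (L + L) ⊗ W L ≈[ 4 * suc L ] 𝟏
euler-≈[] L = ⊗-cancelʳ-≈[] (J₂.qPoch L) (J₂.qPoch-coeff-zero L) (begin
  V (L + L) ⊗ W L ⊗ J₂.qPoch L       ≈⟨ ≈⇒≈[] (⊗-assoc _ _ _) ⟩
  V (L + L) ⊗ (W L ⊗ J₂.qPoch L)     ≈⟨ ≈⇒≈[] (≈-refl ⟨⊗⟩ ≈-sym (qPoch₂-even-odd L)) ⟩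
  V (L + L) ⊗ Q₂.qPoch (L + L)       ≈⟨ ≈⇒≈[] (V⊗qPoch₂≈qPoch₄ (L + L)) ⟩
  J₂.qPoch (L + L)                   ≈⟨ J₂.qPoch-stable (ℕ.m≤m+n L L) ⟩
  J₂.qPoch L                         ≈⟨ ≈⇒≈[] (≈-sym (⊗-identityˡ _)) ⟩
  𝟏 ⊗ J₂.qPoch L                     ∎)
  where open ≈[]-Reasoning (4 * suc L)

-- Gauss: (-q²;q²)_∞ / (q²;q²)_∞ · Σ_n (-1)^n q^(2n²) = 1.
R⊗θ₂-≈[] : ∀ L → R (L + L) ⊗ (𝟏 ⊕ 𝟐 ⊗ J₂.θ₊ L) ≈[ 2 * suc (L + L) ] 𝟏
R⊗θ₂-≈[] L = begin
  R (L + L) ⊗ (𝟏 ⊕ 𝟐 ⊗ J₂.θ₊ L)                 ≈⟨ ≈[]-⊗ ≈[]-refl (≈[]-sym (J₂.qPoch-jacobiProd-≈[] L)) ⟩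
  R (L + L) ⊗ (J₂.qPoch L ⊗ J₂.jacobiProd L)    ≈⟨ ≈⇒≈[] (≈-refl ⟨⊗⟩ (≈-refl ⟨⊗⟩ jacobiProd₂≈W² L)) ⟩
  R (L + L) ⊗ (J₂.qPoch L ⊗ (W L ⊗ W L))        ≈⟨ ≈⇒≈[] (solve 3 (λ r p w → r :* (p :* (w :* w)) := r :* (w :* p) :* w)
                                                      ≈-refl (R (L + L)) (J₂.qPoch L) (W L)) ⟩
  R (L + L) ⊗ (W L ⊗ J₂.qPoch L) ⊗ W L          ≈⟨ ≈⇒≈[] (≈-refl ⟨⊗⟩ ≈-sym (qPoch₂-even-odd L) ⟨⊗⟩ ≈-refl) ⟩
  R (L + L) ⊗ Q₂.qPoch (L + L) ⊗ W L            ≈⟨ ≈⇒≈[] (R⊗qPoch₂≈V (L + L) ⟨⊗⟩ ≈-refl) ⟩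
  V (L + L) ⊗ W L                               ≈⟨ ≈[]-weaken (precision L) (euler-≈[] L) ⟩
  𝟏                                             ∎
  where
  open ≈[]-Reasoning (2 * suc (L + L))
  precision : ∀ L → 2 * suc (L + L) ≤ 4 * suc L
  precision L = ℕ.≤-trans (ℕ.n≤1+n _) (ℕ.≤-trans (ℕ.n≤1+n _) (ℕ.≤-reflexive (eq L)))
    where
    eq : ∀ L → suc (suc (2 * suc (L + L))) ≡ 4 * suc L
    eq = ℕ-Solver.solve-∀

-- Supports modulo 24

Residues : Set
Residues = ℕ → Bool

record SupportedIn (S : Residues) (f : PS) : Set where
  constructor mkSupported
  field vanish : ∀ n → ¬ T (S (n % 24)) → f n ≡ + 0
open SupportedIn public

fromList : List ℕ → Residues
fromList rs r = any (r N.≡ᵇ_) rs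

multiplesOfSquares : ℕ → Residues
multiplesOfSquares c = fromList (map (λ k → (c * (k * k)) % 24) (upTo 24))

sq₂ sq₃ sq₄ : Residues
sq₂ = multiplesOfSquares 2
sq₃ = multiplesOfSquares 3
sq₄ = multiplesOfSquares 4

evens : Residues
evens r = r % 2 N.≡ᵇ 0

-- {r₁ + r₂ mod 24 | r₁ ∈ S, r₂ ∈ S′}
_⊞_ : Residues → Residues → Residues
(S ⊞ S′) r = any (λ r₁ → S r₁ ∧ S′ ((r + (24 ∸ r₁)) % 24)) (upTo 24)

everyResidue : (ℕ → Bool) → Bool
everyResidue p = all p (upTo 24)

everyResidue-sound : ∀ p → T (everyResidue p) → ∀ n → T (p (n % 24))
everyResidue-sound p check n = applyUpTo⁻ id 24 (all⁺ p (upTo 24) check) (m%n<n n 24)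

record Closed (S S′ S″ : Residues) : Set where
  constructor mkClosed
  field closure : ∀ a b → T (S (a % 24)) → T (S′ (b % 24)) → T (S″ ((a + b) % 24))
open Closed public

closed : ∀ S S′ S″ → T (everyResidue λ r₁ → everyResidue λ r₂ → not (S r₁ ∧ S′ r₂) ∨ S″ ((r₁ + r₂) % 24))
       → Closed S S′ S″
closed S S′ S″ check = mkClosed λ a b a∈S b∈S′ → subst (T ∘ S″) (sym (%-distribˡ-+ a b 24))
  (modus-ponens (S (a % 24)) (S′ (b % 24)) (S″ ((a % 24 + b % 24) % 24)) a∈S b∈S′
    (everyResidue-sound (λ r₂ → not (S (a % 24) ∧ S′ r₂) ∨ S″ ((a % 24 + r₂) % 24))
      (everyResidue-sound (λ r₁ → everyResidue λ r₂ → not (S r₁ ∧ S′ r₂) ∨ S″ ((r₁ + r₂) % 24)) check a) b))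
  where
  modus-ponens : ∀ x y z → T x → T y → T (not (x ∧ y) ∨ z) → T z
  modus-ponens true true z _ _ z-holds = z-holds

square-residue : ∀ c S → T (everyResidue λ r → S ((c * (r * r)) % 24)) → ∀ k → T (S ((c * (k * k)) % 24))
square-residue c S check k = subst (T ∘ S) (sym (mod-square k)) (everyResidue-sound (λ r → S ((c * (r * r)) % 24)) check k)
  where
  mod-square : ∀ k → (c * (k * k)) % 24 ≡ (c * ((k % 24) * (k % 24))) % 24
  mod-square k = trans (%-distribˡ-* c (k * k) 24)
    (trans (cong (λ x → ((c % 24) * x) % 24) (%-distribˡ-* k k 24)) (sym (%-distribˡ-* c _ 24)))

supp-≈ : ∀ {S f g} → f ≈ g → SupportedIn S g → SupportedIn S f
supp-≈ f≈g g∈S = mkSupported λ n n∉S → trans (coeff f≈g n) (vanish g∈S n n∉S)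

supp-⊆ : ∀ {S S′ f} → T (everyResidue λ r → not (S r) ∨ S′ r) → SupportedIn S f → SupportedIn S′ f
supp-⊆ {S} {S′} check f∈S = mkSupported λ n n∉S′ →
  vanish f∈S n (λ n∈S → n∉S′ (⊆ (S (n % 24)) (S′ (n % 24)) n∈S (everyResidue-sound (λ r → not (S r) ∨ S′ r) check n)))
  where
  ⊆ : ∀ x y → T x → T (not x ∨ y) → T y
  ⊆ true y _ y-holds = y-holds

supp-⊕ : ∀ {S f g} → SupportedIn S f → SupportedIn S g → SupportedIn S (f ⊕ g)
supp-⊕ {f = f} {g} f∈S g∈S = mkSupported λ n n∉S →
  trans (⊕-coeff f g n) (cong₂ ℤ._+_ (vanish f∈S n n∉S) (vanish g∈S n n∉S))

supp-⊖ : ∀ {S f} → SupportedIn S f → SupportedIn S (⊖ f)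
supp-⊖ {f = f} f∈S = mkSupported λ n n∉S → trans (⊖-coeff f n) (cong ℤ.-_ (vanish f∈S n n∉S))

supp-cst-⊗ : ∀ {S f} c → SupportedIn S f → SupportedIn S (cst c ⊗ f)
supp-cst-⊗ {f = f} c f∈S = mkSupported λ n n∉S →
  trans (cst-⊗-coeff c f n) (trans (cong (c ℤ.*_) (vanish f∈S n n∉S)) (ℤ.*-zeroʳ c))

supp-𝟏 : ∀ {S} → T (S 0) → SupportedIn S 𝟏
supp-𝟏 0∈S = mkSupported λ where
  zero    0∉S → contradiction 0∈S 0∉S
  (suc n) _   → cst-coeff-suc (+ 1) n

supp-q^ : ∀ {S} m → T (S (m % 24)) → SupportedIn S (q^ m)
supp-q^ {S} m m∈S = mkSupported λ n n∉S → q^-coeff-≢ (λ { refl → n∉S m∈S })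

supp-∑ : ∀ {S} K f → (∀ i → SupportedIn S (f i)) → SupportedIn S (∑ K f)
supp-∑ zero    f f∈S = mkSupported λ n _ → coeff cst-0 n
supp-∑ (suc K) f f∈S = supp-⊕ (supp-∑ K f f∈S) (f∈S K)

sumℤ-zero : ∀ {xs} → All (_≡ + 0) xs → sumℤ xs ≡ + 0
sumℤ-zero []           = refl
sumℤ-zero (x≡0 ∷ xs≡0) = cong₂ ℤ._+_ x≡0 (sumℤ-zero xs≡0)

-- Every term f k g (n - k) of the Cauchy product vanishes unless k ∈ S and n - k ∈ S′.
supp-⊗ : ∀ {S S′ S″ f g} → Closed S S′ S″ → SupportedIn S f → SupportedIn S′ g → SupportedIn S″ (f ⊗ g)
supp-⊗ {S} {S′} {S″} {f} {g} S+S′⊆S″ f∈S g∈S′ = mkSupported λ n n∉S″ →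
  trans (sym (coeff (⊛≈⊗ f g) n))
        (sumℤ-zero (map⁺ (applyUpTo⁺₁ {P = λ k → f k ℤ.* g (n ∸ k) ≡ + 0} id (suc n)
                                     λ k<1+n → term (ℕ.≤-pred k<1+n) n∉S″)))
  where
  term : ∀ {k n} → k ≤ n → ¬ T (S″ (n % 24)) → f k ℤ.* g (n ∸ k) ≡ + 0
  term {k} {n} k≤n n∉S″ with T? (S (k % 24)) | T? (S′ ((n ∸ k) % 24))
  ... | no k∉S | _ = trans (cong (ℤ._* g (n ∸ k)) (vanish f∈S k k∉S)) (ℤ.*-zeroˡ (g (n ∸ k)))
  ... | yes _  | no n-k∉S′ = trans (cong (f k ℤ.*_) (vanish g∈S′ (n ∸ k) n-k∉S′)) (ℤ.*-zeroʳ (f k))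
  ... | yes k∈S | yes n-k∈S′ =
    contradiction (subst (λ m → T (S″ (m % 24))) (ℕ.m+[n∸m]≡n k≤n) (closure S+S′⊆S″ k (n ∸ k) k∈S n-k∈S′)) n∉S″

∣-⊕-𝟐⊗ : ∀ k {f g n} → f n ≡ + 0 → k ∣ g n → + 2 ℤ.* k ∣ (f ⊕ 𝟐 ⊗ g) n
∣-⊕-𝟐⊗ k {f} {g} {n} fₙ≡0 k∣gₙ = subst (+ 2 ℤ.* k ∣_) (sym coeff-eq) (*-monoʳ-∣ (+ 2) {k} {g n} k∣gₙ)
  where
  coeff-eq : (f ⊕ 𝟐 ⊗ g) n ≡ + 2 ℤ.* g n
  coeff-eq = trans (⊕-coeff f (𝟐 ⊗ g) n) (trans (cong₂ ℤ._+_ fₙ≡0 (cst-⊗-coeff (+ 2) g n)) (ℤ.+-identityˡ _))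

at0 : Residues
at0 = fromList (0 ∷ [])

E^-at0 : ∀ E (E²≈𝟏 : E ⊗ E ≈ 𝟏) → SupportedIn at0 E → ∀ j → SupportedIn at0 (SymmetricSum.E^_ E E²≈𝟏 j)
E^-at0 E E²≈𝟏 E∈at0 zero    = supp-𝟏 tt
E^-at0 E E²≈𝟏 E∈at0 (suc j) = supp-⊗ (closed at0 at0 at0 tt) E∈at0 (E^-at0 E E²≈𝟏 E∈at0 j)

module Expansion (L : ℕ) where
  X Y : PS
  X = J₂.θ₊ L
  Y = J₃.θ₊ (L + L)

  -- C (1 + 2X) = 1 - 16X⁴
  C : PS
  C = 𝟏 ⊕ ⊖ (𝟐 ⊗ X) ⊕ cst (+ 4) ⊗ (X ⊗ X) ⊕ ⊖ (cst (+ 8) ⊗ (X ⊗ X ⊗ X))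

  xterm : ℕ → PS
  xterm i = J₂.E^ suc i ⊗ J₂.x^ (suc i * suc i)

  Diag Off Z′ Z : PS
  Diag = ∑[ i < L ] (xterm i ⊗ xterm i)
  Off  = ∑[ i < L ] ∑[ j < i ] (xterm i ⊗ xterm j)
  Z′   = ⊖ (X ⊗ X ⊗ X ⊗ Y) ⊕ X ⊗ X ⊗ X ⊗ X ⊗ R (L + L) ⊗ (𝟏 ⊕ 𝟐 ⊗ Y)
  Z    = Off ⊗ Y ⊕ Z′

  F : PS
  F = C ⊕ 𝟐 ⊗ (Y ⊕ 𝟐 ⊗ (⊖ (X ⊗ Y) ⊕ 𝟐 ⊗ (Diag ⊗ Y ⊕ 𝟐 ⊗ Z)))

  partialProd-≈[] : partialProd (L + L) ≈[ L ] F
  partialProd-≈[] = begin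
    partialProd (L + L)
      ≈⟨ ≈⇒≈[] (partialProd-≈ (L + L)) ⟩
    R (L + L) ⊗ (J₃.qPoch (L + L) ⊗ J₃.jacobiProd (L + L))
      ≈⟨ ≈[]-⊗ ≈[]-refl (≈[]-weaken precision₃ (J₃.qPoch-jacobiProd-≈[] (L + L))) ⟩
    R (L + L) ⊗ (𝟏 ⊕ 𝟐 ⊗ Y)
      ≈⟨ ≈⇒≈[] (split (R (L + L)) X Y) ⟩
    R (L + L) ⊗ (𝟏 ⊕ 𝟐 ⊗ X) ⊗ (C ⊗ (𝟏 ⊕ 𝟐 ⊗ Y)) ⊕ cst (+ 16) ⊗ (X ⊗ X ⊗ X ⊗ X ⊗ R (L + L) ⊗ (𝟏 ⊕ 𝟐 ⊗ Y))
      ≈⟨ ≈[]-⊕ (≈[]-⊗ (≈[]-weaken precision₂ (R⊗θ₂-≈[] L)) ≈[]-refl) ≈[]-refl ⟩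
    𝟏 ⊗ (C ⊗ (𝟏 ⊕ 𝟐 ⊗ Y)) ⊕ cst (+ 16) ⊗ (X ⊗ X ⊗ X ⊗ X ⊗ R (L + L) ⊗ (𝟏 ⊕ 𝟐 ⊗ Y))
      ≈⟨ ≈⇒≈[] (expand (R (L + L)) X Y) ⟩
    C ⊕ 𝟐 ⊗ (Y ⊕ 𝟐 ⊗ (⊖ (X ⊗ Y) ⊕ 𝟐 ⊗ ((X ⊗ X) ⊗ Y ⊕ 𝟐 ⊗ Z′)))
      ≈⟨ ≈⇒≈[] (≈-refl ⟨⊕⟩ ≈-refl ⟨⊗⟩ (≈-refl ⟨⊕⟩ ≈-refl ⟨⊗⟩ (≈-refl ⟨⊕⟩ ≈-refl ⟨⊗⟩ square))) ⟩
    C ⊕ 𝟐 ⊗ (Y ⊕ 𝟐 ⊗ (⊖ (X ⊗ Y) ⊕ 𝟐 ⊗ (Diag ⊗ Y ⊕ 𝟐 ⊗ Z))) ∎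
    where
    open ≈[]-Reasoning L
    precision₃ : L ≤ 3 * suc ((L + L) + (L + L))
    precision₃ = ℕ.≤-trans (ℕ.≤-trans (ℕ.m≤m+n L L) (ℕ.m≤m+n (L + L) (L + L))) (ℕ.≤-trans (ℕ.n≤1+n _) (ℕ.m≤n*m _ 3))
    precision₂ : L ≤ 2 * suc (L + L)
    precision₂ = ℕ.≤-trans (ℕ.m≤m+n L L) (ℕ.≤-trans (ℕ.n≤1+n _) (ℕ.m≤n*m _ 2))
    split : ∀ R X Y → R ⊗ (𝟏 ⊕ 𝟐 ⊗ Y) ≈
      R ⊗ (𝟏 ⊕ 𝟐 ⊗ X) ⊗ ((𝟏 ⊕ ⊖ (𝟐 ⊗ X) ⊕ cst (+ 4) ⊗ (X ⊗ X) ⊕ ⊖ (cst (+ 8) ⊗ (X ⊗ X ⊗ X))) ⊗ (𝟏 ⊕ 𝟐 ⊗ Y))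
      ⊕ cst (+ 16) ⊗ (X ⊗ X ⊗ X ⊗ X ⊗ R ⊗ (𝟏 ⊕ 𝟐 ⊗ Y))
    split = solve 3 (λ R X Y → R :* (con (+ 1) :+ con (+ 2) :* Y) :=
      R :* (con (+ 1) :+ con (+ 2) :* X)
        :* ((con (+ 1) :+ :- (con (+ 2) :* X) :+ con (+ 4) :* (X :* X) :+ :- (con (+ 8) :* (X :* X :* X)))
            :* (con (+ 1) :+ con (+ 2) :* Y))
      :+ con (+ 16) :* (X :* X :* X :* X :* R :* (con (+ 1) :+ con (+ 2) :* Y))) ≈-refl
    expand : ∀ R X Y →
      𝟏 ⊗ ((𝟏 ⊕ ⊖ (𝟐 ⊗ X) ⊕ cst (+ 4) ⊗ (X ⊗ X) ⊕ ⊖ (cst (+ 8) ⊗ (X ⊗ X ⊗ X))) ⊗ (𝟏 ⊕ 𝟐 ⊗ Y))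
        ⊕ cst (+ 16) ⊗ (X ⊗ X ⊗ X ⊗ X ⊗ R ⊗ (𝟏 ⊕ 𝟐 ⊗ Y))
      ≈ (𝟏 ⊕ ⊖ (𝟐 ⊗ X) ⊕ cst (+ 4) ⊗ (X ⊗ X) ⊕ ⊖ (cst (+ 8) ⊗ (X ⊗ X ⊗ X)))
        ⊕ 𝟐 ⊗ (Y ⊕ 𝟐 ⊗ (⊖ (X ⊗ Y) ⊕ 𝟐 ⊗ ((X ⊗ X) ⊗ Y
                 ⊕ 𝟐 ⊗ (⊖ (X ⊗ X ⊗ X ⊗ Y) ⊕ X ⊗ X ⊗ X ⊗ X ⊗ R ⊗ (𝟏 ⊕ 𝟐 ⊗ Y)))))
    expand = solve 3 (λ R X Y →
      con (+ 1) :* ((con (+ 1) :+ :- (con (+ 2) :* X) :+ con (+ 4) :* (X :* X) :+ :- (con (+ 8) :* (X :* X :* X)))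
                    :* (con (+ 1) :+ con (+ 2) :* Y))
        :+ con (+ 16) :* (X :* X :* X :* X :* R :* (con (+ 1) :+ con (+ 2) :* Y))
      := (con (+ 1) :+ :- (con (+ 2) :* X) :+ con (+ 4) :* (X :* X) :+ :- (con (+ 8) :* (X :* X :* X)))
        :+ con (+ 2) :* (Y :+ con (+ 2) :* (:- (X :* Y) :+ con (+ 2) :* ((X :* X) :* Y
             :+ con (+ 2) :* (:- (X :* X :* X :* Y) :+ X :* X :* X :* X :* R :* (con (+ 1) :+ con (+ 2) :* Y)))))) ≈-refl
    square : (X ⊗ X) ⊗ Y ⊕ 𝟐 ⊗ Z′ ≈ Diag ⊗ Y ⊕ 𝟐 ⊗ Z
    square = ≈-trans (∑-square L xterm ⟨⊗⟩ ≈-refl ⟨⊕⟩ ≈-refl)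
      (solve 4 (λ D O Y Z′ → (D :+ con (+ 2) :* O) :* Y :+ con (+ 2) :* Z′ := D :* Y :+ con (+ 2) :* (O :* Y :+ Z′))
         ≈-refl Diag Off Y Z′)

  E₂^-at0 : ∀ j → SupportedIn at0 (J₂.E^ j)
  E₂^-at0 = E^-at0 (⊖ 𝟏) ⊖𝟏²≈𝟏 (supp-⊖ (supp-𝟏 tt))

  E₃^-at0 : ∀ j → SupportedIn at0 (J₃.E^ j)
  E₃^-at0 = E^-at0 𝟏 (⊗-identityˡ 𝟏) (supp-𝟏 tt)

  X-supp : SupportedIn sq₂ X
  X-supp = supp-∑ L xterm λ i → supp-⊗ (closed at0 sq₂ sq₂ tt) (E₂^-at0 (suc i))
    (supp-q^ (2 * (suc i * suc i)) (square-residue 2 sq₂ tt (suc i)))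

  Y-supp : SupportedIn sq₃ Y
  Y-supp = supp-∑ (L + L) _ λ i → supp-⊗ (closed at0 sq₃ sq₃ tt) (E₃^-at0 (suc i))
    (supp-q^ (3 * (suc i * suc i)) (square-residue 3 sq₃ tt (suc i)))

  Diag-supp : SupportedIn sq₄ Diag
  Diag-supp = supp-∑ L _ λ i → supp-≈ (rearrange i)
    (supp-⊗ (closed at0 sq₄ sq₄ tt) (supp-⊗ (closed at0 at0 at0 tt) (E₂^-at0 (suc i)) (E₂^-at0 (suc i)))
      (supp-q^ (4 * (suc i * suc i)) (square-residue 4 sq₄ tt (suc i))))
    where
    double : ∀ k → 2 * k + 2 * k ≡ 4 * k
    double = ℕ-Solver.solve-∀
    rearrange : ∀ i → xterm i ⊗ xterm i ≈ J₂.E^ suc i ⊗ J₂.E^ suc i ⊗ q^ (4 * (suc i * suc i))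
    rearrange i = ≈-trans
      (solve 2 (λ e y → e :* y :* (e :* y) := e :* e :* (y :* y)) ≈-refl (J₂.E^ suc i) (J₂.x^ (suc i * suc i)))
      (≈-refl ⟨⊗⟩ ≈-trans (q^-+ _ _) (≈-reflexive (cong q^_ (double (suc i * suc i)))))

  C-supp : SupportedIn evens C
  C-supp = supp-⊕ (supp-⊕ (supp-⊕ (supp-𝟏 tt) (supp-⊖ (supp-cst-⊗ (+ 2) X-even)))
                          (supp-cst-⊗ (+ 4) X²-even))
                  (supp-⊖ (supp-cst-⊗ (+ 8) (supp-⊗ even+even X²-even X-even)))
    where
    even+even : Closed evens evens evens
    even+even = closed evens evens evens tt
    X-even : SupportedIn evens X
    X-even = supp-⊆ tt X-supp
    X²-even : SupportedIn evens (X ⊗ X)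
    X²-even = supp-⊗ even+even X-even X-even

  XY-supp : SupportedIn (sq₂ ⊞ sq₃) (⊖ (X ⊗ Y))
  XY-supp = supp-⊖ (supp-⊗ (closed sq₂ sq₃ (sq₂ ⊞ sq₃) tt) X-supp Y-supp)

  DiagY-supp : SupportedIn (sq₄ ⊞ sq₃) (Diag ⊗ Y)
  DiagY-supp = supp-⊗ (closed sq₄ sq₃ (sq₄ ⊞ sq₃) tt) Diag-supp Y-supp

  4∣F : ∀ n → ¬ T (evens (n % 24)) → ¬ T (sq₃ (n % 24)) → + 4 ∣ F n
  4∣F n n∉C n∉Y = ∣-⊕-𝟐⊗ (+ 2) (vanish C-supp n n∉C) (∣-⊕-𝟐⊗ (+ 1) (vanish Y-supp n n∉Y) (1∣ _))

  8∣F : ∀ n → ¬ T (evens (n % 24)) → ¬ T (sq₃ (n % 24)) → ¬ T ((sq₂ ⊞ sq₃) (n % 24)) → + 8 ∣ F n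
  8∣F n n∉C n∉Y n∉XY = ∣-⊕-𝟐⊗ (+ 4) (vanish C-supp n n∉C) (∣-⊕-𝟐⊗ (+ 2) (vanish Y-supp n n∉Y)
    (∣-⊕-𝟐⊗ (+ 1) (vanish XY-supp n n∉XY) (1∣ _)))

  16∣F : ∀ n → ¬ T (evens (n % 24)) → ¬ T (sq₃ (n % 24)) → ¬ T ((sq₂ ⊞ sq₃) (n % 24))
       → ¬ T ((sq₄ ⊞ sq₃) (n % 24)) → + 16 ∣ F n
  16∣F n n∉C n∉Y n∉XY n∉DY = ∣-⊕-𝟐⊗ (+ 8) (vanish C-supp n n∉C) (∣-⊕-𝟐⊗ (+ 4) (vanish Y-supp n n∉Y)
    (∣-⊕-𝟐⊗ (+ 2) (vanish XY-supp n n∉XY) (∣-⊕-𝟐⊗ (+ 1) (vanish DiagY-supp n n∉DY) (1∣ _))))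

s≡F : ∀ n → s n ≡ Expansion.F (suc n) n
s≡F n = trans (s≡partialProd {n} {suc n + suc n} (ℕ.m≤m+n (suc n) (suc n)))
              (coeff< (Expansion.partialProd-≈[] (suc n)) (ℕ.n<1+n n))

avoids : ∀ (S : Residues) {m r : ℕ} → m ≡ r → T (not (S r)) → ¬ T (S m)
avoids S {r = r} refl = T-not (S r)
  where
  T-not : ∀ b → T (not b) → ¬ T b
  T-not true ()

module _ (n : ℕ) {r : ℕ} (n%24≡r : n % 24 ≡ r) where
  open Expansion (suc n) using (4∣F; 8∣F; 16∣F)

  4∣s : T (not (evens r)) → T (not (sq₃ r)) → + 4 ∣ s n
  4∣s c y = subst (+ 4 ∣_) (sym (s≡F n)) (4∣F n (avoids evens n%24≡r c) (avoids sq₃ n%24≡r y))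

  8∣s : T (not (evens r)) → T (not (sq₃ r)) → T (not ((sq₂ ⊞ sq₃) r)) → + 8 ∣ s n
  8∣s c y xy = subst (+ 8 ∣_) (sym (s≡F n))
    (8∣F n (avoids evens n%24≡r c) (avoids sq₃ n%24≡r y) (avoids (sq₂ ⊞ sq₃) n%24≡r xy))

  16∣s : T (not (evens r)) → T (not (sq₃ r)) → T (not ((sq₂ ⊞ sq₃) r)) → T (not ((sq₄ ⊞ sq₃) r))
       → + 16 ∣ s n
  16∣s c y xy dy = subst (+ 16 ∣_) (sym (s≡F n))
    (16∣F n (avoids evens n%24≡r c) (avoids sq₃ n%24≡r y) (avoids (sq₂ ⊞ sq₃) n%24≡r xy)
          (avoids (sq₄ ⊞ sq₃) n%24≡r dy))

residue-24 : ∀ n r → (24 * n + r) % 24 ≡ r % 24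
residue-24 n r = trans (cong (_% 24) (reorder n r)) ([m+kn]%n≡m%n r n 24)
  where
  reorder : ∀ n r → 24 * n + r ≡ r + n * 24
  reorder = ℕ-Solver.solve-∀

residue-12 : ∀ n → (12 * n + 1) % 24 ≡ 1 ⊎ (12 * n + 1) % 24 ≡ 13
residue-12 zero          = inj₁ refl
residue-12 (suc zero)    = inj₂ refl
residue-12 (suc (suc n)) = Sum.map (trans step) (trans step) (residue-12 n)
  where
  reorder : ∀ n → 12 * suc (suc n) + 1 ≡ (12 * n + 1) + 1 * 24
  reorder = ℕ-Solver.solve-∀
  step : (12 * suc (suc n) + 1) % 24 ≡ (12 * n + 1) % 24
  step = trans (cong (_% 24) (reorder n)) ([m+kn]%n≡m%n (12 * n + 1) 1 24)

-- Each tt is the computation that the residue lies outside the support sets in question.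
theorem8 : (n : ℕ) →
    ((+ 4) ∣ s (24 N.* n N.+ 9)) × ((+ 4) ∣ s (24 N.* n N.+ 15)) × ((+ 4) ∣ s (24 N.* n N.+ 21))
      × ((+ 8) ∣ s (24 N.* n N.+ 23)) × ((+ 8) ∣ s (24 N.* n N.+ 17)) × ((+ 16) ∣ s (12 N.* n N.+ 1))
theorem8 n =
    4∣s (24 * n + 9)  (residue-24 n 9)  tt tt
  , 4∣s (24 * n + 15) (residue-24 n 15) tt tt
  , 4∣s (24 * n + 21) (residue-24 n 21) tt tt
  , 8∣s (24 * n + 23) (residue-24 n 23) tt tt tt
  , 8∣s (24 * n + 17) (residue-24 n 17) tt tt tt
  , [ (λ ≡1  → 16∣s (12 * n + 1) ≡1  tt tt tt tt)
    , (λ ≡13 → 16∣s (12 * n + 1) ≡13 tt tt tt tt) ]′ (residue-12 n)
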